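{- Let $n\ge 1$. Let $\mathcal{D}_n$ be the set of permutations of $\{1,2,\dots,n\}$ with no fixed points, and $\mathcal{F}_n$ the set of permutations of $\{1,2,\dots,n\}$ with exactly one fixed point. If $n$ is even, put $\mathcal{D}^\ast_n=\mathcal{D}_n\setminus\{(1,2)(3,4)\cdots(n-1,n)\}$ and $\mathcal{F}^\ast_n=\mathcal{F}_n$; if $n$ is odd, put $\mathcal{D}^\ast_n=\mathcal{D}_n$ and $\mathcal{F}^\ast_n=\mathcal{F}_n\setminus\{(1)(2,3)(4,5)\cdots(n-1,n)\}$. For $\pi\in\mathcal{D}^\ast_n$ written in canonical cycle notation, let $k$ be the largest non-negative integer such that the cycle notation of $\pi$ begins with $(1,2)(3,4)\cdots(2k-1,2k)$; then $0\le k<n/2$. Define $\psi(\pi)$ as follows; in both cases all cycles of $\pi$ not mentioned are kept unchanged. (i) If the cycle of $\pi$ containing $2k+1$ has at least $3$ elements, write it as $(2k+1,a_1,a_2,\dots,a_j)$ with $j\ge 2$, so that $\pi=(1,2)(3,4)\cdots(2k-1,2k)(2k+1,a_1,a_2,\dots,a_j)\cdots$. Replace these first $k+1$ cycles by $(1)(2,3)(4,5)\cdots(2k-2,2k-1)(2k,a_1)(2k+1,a_2,\dots,a_j)$. When $k=0$, this means the first cycle $(1,a_1,a_2,\dots,a_j)$ is replaced by $(a_1)(1,a_2,\dots,a_j)$, so the fixed point of $\psi(\pi)$ is $a_1$. (ii) Otherwise, the cycle containing $2k+1$ is a $2$-cycle $(2k+1,a_1)$. Then $\pi=(1,2)\cdots(2k-1,2k)(2k+1,a_1)(2k+2,a_2,\dots,a_j)\cdots$,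 where $(2k+2,a_2,\dots,a_j)$ is the cycle containing $2k+2$. Replace these first $k+2$ cycles by $(1)(2,3)(4,5)\cdots(2k,2k+1)(2k+2,a_1,a_2,\dots,a_j)$. When $k=0$, this means the first two cycles $(1,a_1)(2,a_2,\dots,a_j)$ are replaced by $(1)(2,a_1,a_2,\dots,a_j)$. Then $\psi$ is a well-defined bijection from $\mathcal{D}^\ast_n$ onto $\mathcal{F}^\ast_n$.
   Context: Derangements are written in canonical cycle notation: each cycle begins with its smallest element, and cycles are listed in increasing order of their first elements. -}

module Defs where

open import Data.Nat using (ℕ; zero; suc; _*_; _∸_; _+_; _<?_; _≡ᵇ_; _<ᵇ_)
open import Data.Nat.Divisibility using (_∣_)
open import Data.Fin using (Fin; toℕ; fromℕ<)
open import Data.Fin.Properties using (_≟_)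
open import Data.Bool using (Bool; true; false; if_then_else_; _∧_; not)
open import Data.Product using (Σ; _×_)
open import Relation.Nullary using (¬_; yes; no)
open import Relation.Nullary.Decidable using (⌊_⌋)
open import Relation.Binary.PropositionalEquality using (_≡_; _≗_)
open import Function.Definitions using (Bijective)

-- Convention: the ground set {1,…,n} is represented by Fin n, the element
-- with 1-based label m being the Fin n value with toℕ equal to m ∸ 1.
-- A permutation of {1,…,n} is a bijection Fin n → Fin n; permutations are
-- compared pointwise (_≗_).

IsPerm : ∀ {n} → (Fin n → Fin n) → Set
IsPerm f = Bijective _≡_ _≡_ f

IsDerangement : ∀ {n} → (Fin n → Fin n) → Set
IsDerangement {n} f = (x : Fin n) → ¬ (f x ≡ x)

HasExactlyOneFixedPoint : ∀ {n} → (Fin n → Fin n) → Set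
HasExactlyOneFixedPoint {n} f =
  Σ (Fin n) λ x → (f x ≡ x) × ((y : Fin n) → f y ≡ y → y ≡ x)

-- the element whose 0-based index is m (default d if m ≥ n)
at : ∀ {n} → ℕ → Fin n → Fin n
at {n} m d with m <? n
... | yes p = fromℕ< p
... | no _  = d

next : ∀ {n} → Fin n → Fin n
next x = at (suc (toℕ x)) x

prev : ∀ {n} → Fin n → Fin n
prev x = at (toℕ x ∸ 1) x

isEven : ℕ → Bool
isEven zero = true
isEven (suc m) = not (isEven m)

-- (1,2)(3,4)⋯(n-1,n)  (relevant for n even): 0-based 2i ↔ 2i+1
pairing : ∀ {n} → Fin n → Fin n
pairing x = if isEven (toℕ x) then next x else prev x

-- (1)(2,3)(4,5)⋯(n-1,n)  (relevant for n odd): 0-based 0 fixed, 2i-1 ↔ 2i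
pairing′ : ∀ {n} → Fin n → Fin n
pairing′ x =
  if toℕ x ≡ᵇ 0 then x
  else (if isEven (toℕ x) then prev x else next x)

-- D*_n and F*_n (membership predicates on functions; used together with IsPerm)
DStar : (n : ℕ) → (Fin n → Fin n) → Set
DStar n f = IsDerangement f × (2 ∣ n → ¬ (f ≗ pairing))

FStar : (n : ℕ) → (Fin n → Fin n) → Set
FStar n f = HasExactlyOneFixedPoint f × (¬ (2 ∣ n) → ¬ (f ≗ pairing′))

-- π as a function on 0-based indices (identity outside [0,n))
valℕ : ∀ {n} → (Fin n → Fin n) → ℕ → ℕ
valℕ {n} f m with m <? n
... | yes p = toℕ (f (fromℕ< p))
... | no _  = m

-- does π contain the 2-cycle (2m+1, 2m+2) (1-based), i.e. 0-based (2m, 2m+1)?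
pairAt : ∀ {n} → (Fin n → Fin n) → ℕ → Bool
pairAt f m = (valℕ f (2 * m) ≡ᵇ suc (2 * m)) ∧ (valℕ f (suc (2 * m)) ≡ᵇ 2 * m)

countPairs : ∀ {n} → (Fin n → Fin n) → ℕ → ℕ → ℕ
countPairs f zero m = m
countPairs f (suc fuel) m = if pairAt f m then countPairs f fuel (suc m) else m

-- k(π): the largest k such that the canonical cycle notation of π begins with
-- (1,2)(3,4)⋯(2k-1,2k), i.e. π(2i-1)=2i and π(2i)=2i-1 for all 1 ≤ i ≤ k.
kOf : ∀ {n} → (Fin n → Fin n) → ℕ
kOf {n} f = countPairs f n 0

-- ψ, written out pointwise (0-based indices t = toℕ x).
-- P = element 2k+1, a₁ = π(P), Q = element 2k+2.
ψ : ∀ {n} → (Fin n → Fin n) → (Fin n → Fin n)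
ψ π x =
  let k  = kOf π
      t  = toℕ x
      P  = at (2 * k) x
      a₁ = π P
      Q  = at (suc (2 * k)) x
      -- swap of the prefix: 1-based 2i ↦ 2i+1, 2i+1 ↦ 2i
      sh = if isEven t then prev x else next x
  in if not ⌊ π a₁ ≟ P ⌋
     then
       -- case (i): cycle (2k+1, a₁, a₂, …, a_j) with j ≥ 2, a₂ = π a₁;
       -- result (1)(2,3)⋯(2k-2,2k-1)(2k,a₁)(2k+1,a₂,…,a_j)
       (if ⌊ x ≟ a₁ ⌋ then (if k ≡ᵇ 0 then x else at (2 * k ∸ 1) x)
        else if t ≡ᵇ 0 then (if k ≡ᵇ 0 then π a₁ else x)
        else if t <ᵇ 2 * k ∸ 1 then sh
        else if t ≡ᵇ 2 * k ∸ 1 then a₁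
        else if t ≡ᵇ 2 * k then π a₁
        else π x)
     else
       -- case (ii): π = (1,2)⋯(2k-1,2k)(2k+1,a₁)(2k+2,a₂,…,a_j)⋯;
       -- result (1)(2,3)⋯(2k,2k+1)(2k+2,a₁,a₂,…,a_j)
       (if t ≡ᵇ 0 then x
        else if t <ᵇ suc (2 * k) then sh
        else if t ≡ᵇ suc (2 * k) then a₁
        else if ⌊ x ≟ a₁ ⌋ then π Q
        else π x)

module Submission where

-- Everything is transported from Fin n to maps ℕ → ℕ on 0-based
-- indices (valℕ; index t is the paper's element t+1), where ψ π becomes an
-- explicit case expression Ψ (valℕ π) k in the prefix length k = kOf π
-- (toℕ-ψ).  Moreover g has a Shape — which of the
-- cases produced it, read off from g alone — and π = unψ s g.  A map with a
-- unique fixed point has only one shape (HasShape-unique), which gives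
-- injectivity.  Conversely, for σ ∈ ℱ*ₙ we determine its shape s, show that
-- unψ s σ is a derangement with the prefix length encoded in s which Ψ sends
-- back to σ (PreimageI₀, PreimageI₊, PreimageII, FixedAtZero), and lift this
-- Candidate to Fin n (preimage-from-indices); this gives surjectivity.

open import Defs
open import Data.Nat using (ℕ; zero; suc; _+_; _*_; _∸_; _≤_; _<_; _≡ᵇ_; _<ᵇ_; _<?_; _≟_; z≤n; s≤s; s≤s⁻¹)
open import Data.Nat.Properties
open import Data.Nat.Divisibility using (_∣_; divides)
open import Data.Bool using (Bool; true; false; if_then_else_; not; _∧_; T)
open import Data.Fin using (Fin; toℕ; fromℕ<; punchOut)
import Data.Fin.Properties as FP
open import Data.Product using (Σ; _×_; _,_; proj₁; proj₂)
open import Data.Sum using (_⊎_; inj₁; inj₂)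
open import Data.Empty using (⊥; ⊥-elim)
open import Data.Unit using (tt)
open import Relation.Nullary using (¬_; yes; no; Dec)
open import Relation.Nullary.Decidable using (⌊_⌋)
open import Relation.Binary.PropositionalEquality
open import Relation.Binary.Definitions using (tri<; tri≈; tri>)
open import Function using (_∘′_)

-- If an injective f missed y, punching y out of its values would give an
-- injective map Fin (suc n) → Fin n, contradicting the pigeonhole principle.
injective⇒surjective : ∀ {n} (f : Fin n → Fin n) → (∀ {x y} → f x ≡ f y → x ≡ y) →
                       ∀ y → Σ (Fin n) λ x → f x ≡ y
injective⇒surjective {suc n} f inj y with FP.any? (λ x → f x FP.≟ y)
... | yes hit = hit
... | no miss =
  let (i , j , i<j , same) = FP.pigeonhole (n<1+n n) (λ x → punchOut (y≢f x))
  in ⊥-elim (FP.<⇒≢ i<j (inj (FP.punchOut-injective (y≢f i) (y≢f j) same)))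
  where
  y≢f : ∀ x → y ≢ f x
  y≢f x e = miss (x , sym e)

injective⇒isPerm : ∀ {n} (f : Fin n → Fin n) → (∀ {x y} → f x ≡ f y → x ≡ y) → IsPerm f
injective⇒isPerm f inj = inj , λ y → proj₁ (injective⇒surjective f inj y) , λ { refl → proj₂ (injective⇒surjective f inj y) }

-- A surjective f has an injective section h; h is then surjective too, which
-- makes f injective.
surjective⇒isPerm : ∀ {n} (f : Fin n → Fin n) → (∀ y → Σ (Fin n) λ x → f x ≡ y) → IsPerm f
surjective⇒isPerm {n} f onto = injective⇒isPerm f inj
  where
  h : Fin n → Fin n
  h y = proj₁ (onto y)
  fh : ∀ y → f (h y) ≡ y
  fh y = proj₂ (onto y)
  hinj : ∀ {x y} → h x ≡ h y → x ≡ y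
  hinj {x} {y} e = trans (sym (fh x)) (trans (cong f e) (fh y))
  inj : ∀ {x y} → f x ≡ f y → x ≡ y
  inj {x} {y} e with injective⇒surjective h hinj x | injective⇒surjective h hinj y
  ... | x' , refl | y' , refl = cong h (trans (sym (fh x')) (trans e (fh y')))

T⇒true : ∀ {b} → T b → b ≡ true
T⇒true {true} _ = refl

¬T⇒false : ∀ {b} → ¬ T b → b ≡ false
¬T⇒false {true} h = ⊥-elim (h tt)
¬T⇒false {false} _ = refl

≡⇒≡ᵇtrue : ∀ {m n} → m ≡ n → (m ≡ᵇ n) ≡ true
≡⇒≡ᵇtrue {m} {n} e = T⇒true (≡⇒≡ᵇ m n e)

≢⇒≡ᵇfalse : ∀ {m n} → m ≢ n → (m ≡ᵇ n) ≡ false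
≢⇒≡ᵇfalse {m} {n} ne = ¬T⇒false (λ t → ne (≡ᵇ⇒≡ m n t))

<⇒<ᵇtrue : ∀ {m n} → m < n → (m <ᵇ n) ≡ true
<⇒<ᵇtrue {m} {n} p = T⇒true (<⇒<ᵇ p)

≮⇒<ᵇfalse : ∀ {m n} → ¬ m < n → (m <ᵇ n) ≡ false
≮⇒<ᵇfalse {m} {n} ne = ¬T⇒false (λ t → ne (<ᵇ⇒< m n t))

≡ᵇtrue⇒≡ : ∀ {m n} → (m ≡ᵇ n) ≡ true → m ≡ n
≡ᵇtrue⇒≡ {m} {n} e = ≡ᵇ⇒≡ m n (subst T (sym e) tt)

true≢false : true ≢ false
true≢false ()

n≢1+n : ∀ n → n ≢ suc n
n≢1+n n e = 1+n≢n (sym e)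

∧-true : ∀ {x y} → (x ∧ y) ≡ true → x ≡ true × y ≡ true
∧-true {true} {true} _ = refl , refl

∧-false : ∀ {x y} → (x ∧ y) ≡ false → x ≡ false ⊎ y ≡ false
∧-false {false} _ = inj₁ refl
∧-false {true} {false} _ = inj₂ refl

at≡fromℕ< : ∀ {n} m (d : Fin n) (p : m < n) → at m d ≡ fromℕ< p
at≡fromℕ< {n} m d p with m <? n
... | yes q = refl
... | no q = ⊥-elim (q p)

toℕ-at : ∀ {n} m (d : Fin n) → m < n → toℕ (at m d) ≡ m
toℕ-at m d p rewrite at≡fromℕ< m d p = FP.toℕ-fromℕ< p

valℕ-inside : ∀ {n} (f : Fin n → Fin n) t (p : t < n) → valℕ f t ≡ toℕ (f (fromℕ< p))
valℕ-inside {n} f t p with t <? n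
... | yes q = refl
... | no q = ⊥-elim (q p)

valℕ-outside : ∀ {n} (f : Fin n → Fin n) t → ¬ t < n → valℕ f t ≡ t
valℕ-outside {n} f t p with t <? n
... | yes q = ⊥-elim (p q)
... | no q = refl

valℕ-toℕ : ∀ {n} (f : Fin n → Fin n) (x : Fin n) → valℕ f (toℕ x) ≡ toℕ (f x)
valℕ-toℕ f x = trans (valℕ-inside f (toℕ x) (FP.toℕ<n x)) (cong (λ z → toℕ (f z)) (FP.fromℕ<-toℕ x (FP.toℕ<n x)))

valℕ-cong : ∀ {n} (f g : Fin n → Fin n) → (∀ x → f x ≡ g x) → ∀ t → valℕ f t ≡ valℕ g t
valℕ-cong {n} f g h t with t <? n
... | yes q = cong toℕ (h (fromℕ< q))
... | no q = refl

valℕ-< : ∀ {n} (f : Fin n → Fin n) t → t < n → valℕ f t < n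
valℕ-< f t p rewrite valℕ-inside f t p = FP.toℕ<n _

⌊≟⌋≡toℕ≡ᵇ : ∀ {n} (x y : Fin n) → ⌊ x FP.≟ y ⌋ ≡ (toℕ x ≡ᵇ toℕ y)
⌊≟⌋≡toℕ≡ᵇ x y with x FP.≟ y
... | yes refl = sym (≡⇒≡ᵇtrue {toℕ x} refl)
... | no ne = sym (≢⇒≡ᵇfalse (λ e → ne (FP.toℕ-injective e)))

toℕ-prev : ∀ {n} (x : Fin n) → toℕ (prev x) ≡ toℕ x ∸ 1
toℕ-prev x = toℕ-at (toℕ x ∸ 1) x (≤-<-trans (m∸n≤m (toℕ x) 1) (FP.toℕ<n x))

toℕ-next : ∀ {n} (x : Fin n) → suc (toℕ x) < n → toℕ (next x) ≡ suc (toℕ x)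
toℕ-next x p = toℕ-at (suc (toℕ x)) x p

-- Parity and the two involutions on indices: swapEven = (0 1)(2 3)⋯ and
-- swapOdd = (1 2)(3 4)⋯, the index versions of pairing and pairing′.

isEven-2* : ∀ k → isEven (2 * k) ≡ true
isEven-2* zero = refl
isEven-2* (suc k) rewrite +-suc k (k + 0) with isEven (k + (k + 0)) | isEven-2* k
... | true | _ = refl

2*suc : ∀ m → 2 * suc m ≡ suc (suc (2 * m))
2*suc m = cong suc (+-suc m (m + 0))

swapEven : ℕ → ℕ
swapEven t = if isEven t then suc t else t ∸ 1

swapOdd : ℕ → ℕ
swapOdd t = if isEven t then t ∸ 1 else suc t

swapEven-even : ∀ i → swapEven (2 * i) ≡ suc (2 * i)
swapEven-even i rewrite isEven-2* i = refl

swapEven-odd : ∀ i → swapEven (suc (2 * i)) ≡ 2 * i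
swapEven-odd i rewrite isEven-2* i = refl

swapOdd-odd : ∀ i → swapOdd (suc (2 * i)) ≡ suc (suc (2 * i))
swapOdd-odd i rewrite isEven-2* i = refl

swapOdd-even : ∀ i → swapOdd (suc (suc (2 * i))) ≡ suc (2 * i)
swapOdd-even i rewrite isEven-2* i = refl

parity : ∀ t → Σ ℕ λ i → (t ≡ 2 * i) ⊎ (t ≡ suc (2 * i))
parity zero = 0 , inj₁ refl
parity (suc t) with parity t
... | i , inj₁ e = i , inj₂ (cong suc e)
... | i , inj₂ e = suc i , inj₁ (trans (cong suc e) (sym (2*suc i)))

parity⁺ : ∀ t → 1 ≤ t → Σ ℕ λ i → (t ≡ suc (2 * i)) ⊎ (t ≡ suc (suc (2 * i)))
parity⁺ (suc t) _ with parity t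
... | i , inj₁ e = i , inj₁ (cong suc e)
... | i , inj₂ e = i , inj₂ (cong suc e)

pairs⇒below : ∀ (P : ℕ → Set) k → (∀ i → i < k → P (2 * i) × P (suc (2 * i))) → ∀ t → t < 2 * k → P t
pairs⇒below P zero h t ()
pairs⇒below P (suc k) h t t< with t <? 2 * k
... | yes p = pairs⇒below P k (λ i i< → h i (m<n⇒m<1+n i<)) t p
... | no p with parity t
...   | i , inj₁ e = subst P (sym e) (proj₁ (h i (*-cancelˡ-< 2 i (suc k) (≤-trans (s≤s (≤-reflexive (sym e))) t<))))
...   | i , inj₂ e = subst P (sym e) (proj₂ (h i (*-cancelˡ-< 2 i (suc k) (≤-trans (s≤s (≤-trans (n≤1+n _) (≤-reflexive (sym e)))) t<))))

swapEven-involutive : ∀ t → swapEven (swapEven t) ≡ t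
swapEven-involutive t with parity t
... | i , inj₁ refl rewrite swapEven-even i = swapEven-odd i
... | i , inj₂ refl rewrite swapEven-odd i = swapEven-even i

swapEven-no-fixed : ∀ t → swapEven t ≢ t
swapEven-no-fixed t with parity t
... | i , inj₁ refl rewrite swapEven-even i = n≢1+n _ ∘′ sym
... | i , inj₂ refl rewrite swapEven-odd i = n≢1+n _

swapEven-< : ∀ t k → t < 2 * k → swapEven t < 2 * k
swapEven-< t k p with parity t
... | i , inj₂ refl rewrite swapEven-odd i = ≤-trans (n≤1+n _) p
... | i , inj₁ refl rewrite swapEven-even i = lem
  where
  i<k : i < k
  i<k = *-cancelˡ-< 2 i k p
  lem : suc (suc (2 * i)) ≤ 2 * k
  lem = subst (_≤ 2 * k) (2*suc i) (*-monoʳ-≤ 2 i<k)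

swapOdd-involutive : ∀ t → 1 ≤ t → swapOdd (swapOdd t) ≡ t
swapOdd-involutive t p with parity⁺ t p
... | i , inj₁ refl rewrite swapOdd-odd i = swapOdd-even i
... | i , inj₂ refl rewrite swapOdd-even i = swapOdd-odd i

swapOdd-no-fixed : ∀ t → 1 ≤ t → swapOdd t ≢ t
swapOdd-no-fixed t p with parity⁺ t p
... | i , inj₁ refl rewrite swapOdd-odd i = λ e → n≢1+n _ (sym e)
... | i , inj₂ refl rewrite swapOdd-even i = n≢1+n _

swapOdd-range : ∀ t j → 1 ≤ t → t < suc (2 * j) → 1 ≤ swapOdd t × swapOdd t < suc (2 * j)
swapOdd-range t j p q with parity⁺ t p
... | i , inj₂ refl rewrite swapOdd-even i = s≤s z≤n , ≤-trans (n≤1+n _) q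
... | i , inj₁ refl rewrite swapOdd-odd i = s≤s z≤n , s≤s lem
  where
  i<j : i < j
  i<j = *-cancelˡ-< 2 i j (s≤s⁻¹ q)
  lem : suc (suc (2 * i)) ≤ 2 * j
  lem = subst (_≤ 2 * j) (2*suc i) (*-monoʳ-≤ 2 i<j)

toℕ-pairing : ∀ {n} (x : Fin n) → swapEven (toℕ x) < n → toℕ (pairing x) ≡ swapEven (toℕ x)
toℕ-pairing x p with isEven (toℕ x)
... | true = toℕ-next x p
... | false = toℕ-prev x

toℕ-pairing′-zero : ∀ {n} (x : Fin n) → toℕ x ≡ 0 → toℕ (pairing′ x) ≡ 0
toℕ-pairing′-zero x e rewrite ≡⇒≡ᵇtrue e = e

toℕ-pairing′ : ∀ {n} (x : Fin n) → toℕ x ≢ 0 → swapOdd (toℕ x) < n → toℕ (pairing′ x) ≡ swapOdd (toℕ x)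
toℕ-pairing′ x ne p rewrite ≢⇒≡ᵇfalse ne with isEven (toℕ x)
... | true = toℕ-prev x
... | false = toℕ-next x p

2∣2*k : ∀ k → 2 ∣ 2 * k
2∣2*k k = divides k (*-comm 2 k)

2∤1+2*k : ∀ k → ¬ (2 ∣ suc (2 * k))
2∤1+2*k k (divides q e) = lem k q (trans e (*-comm q 2))
  where
  lem : ∀ k q → suc (2 * k) ≢ 2 * q
  lem zero zero ()
  lem zero (suc q) e = 0≢1+n (suc-injective (trans e (2*suc q)))
  lem (suc k) zero e rewrite 2*suc k = 0≢1+n (sym e)
  lem (suc k) (suc q) e rewrite 2*suc k | 2*suc q = lem k q (suc-injective (suc-injective e))

2*k≡0⇒k≡0 : ∀ k → 2 * k ≡ 0 → k ≡ 0
2*k≡0⇒k≡0 zero _ = refl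

2*k∸1<2*k : ∀ k → k ≢ 0 → 2 * k ∸ 1 < 2 * k
2*k∸1<2*k zero ne = ⊥-elim (ne refl)
2*k∸1<2*k (suc k) ne = ≤-refl

2*k∸1≢0 : ∀ k → k ≢ 0 → 2 * k ∸ 1 ≢ 0
2*k∸1≢0 zero ne = ⊥-elim (ne refl)
2*k∸1≢0 (suc k) ne rewrite +-suc k (k + 0) = λ ()

-- ψ on indices.  Ψ f k is ψ written for a function f : ℕ → ℕ and prefix
-- length k; toℕ-ψ says that ψ π is Ψ (valℕ π) (kOf π) on indices.

-- ψ π x with its two decisions abstracted: b1 says that P (index 2k) lies
-- in a 2-cycle of π (case (ii)), bx that x = a₁ = π P.  By definition
-- ψ π x = ψ-bits b1 bx (kOf π) π x P Q for the obvious b1, bx, P, Q.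
ψ-bits : ∀ {n} → Bool → Bool → ℕ → (Fin n → Fin n) → (x P Q : Fin n) → Fin n
ψ-bits b1 bx k π x P Q =
  let t  = toℕ x
      a₁ = π P
      sh = if isEven t then prev x else next x
  in if not b1
     then
       (if bx then (if k ≡ᵇ 0 then x else at (2 * k ∸ 1) x)
        else if t ≡ᵇ 0 then (if k ≡ᵇ 0 then π a₁ else x)
        else if t <ᵇ 2 * k ∸ 1 then sh
        else if t ≡ᵇ 2 * k ∸ 1 then a₁
        else if t ≡ᵇ 2 * k then π a₁
        else π x)
     else
       (if t ≡ᵇ 0 then x
        else if t <ᵇ suc (2 * k) then sh
        else if t ≡ᵇ suc (2 * k) then a₁
        else if bx then π Q
        else π x)

Ψ-bits : Bool → Bool → (ℕ → ℕ) → ℕ → ℕ → ℕ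
Ψ-bits b1 bx f k t =
  let A = f (2 * k) in
  if not b1
  then (if bx then (if k ≡ᵇ 0 then t else 2 * k ∸ 1)
        else if t ≡ᵇ 0 then (if k ≡ᵇ 0 then f A else t)
        else if t <ᵇ 2 * k ∸ 1 then swapOdd t
        else if t ≡ᵇ 2 * k ∸ 1 then A
        else if t ≡ᵇ 2 * k then f A
        else f t)
  else (if t ≡ᵇ 0 then t
        else if t <ᵇ suc (2 * k) then swapOdd t
        else if t ≡ᵇ suc (2 * k) then A
        else if bx then f (suc (2 * k))
        else f t)

Ψ : (ℕ → ℕ) → ℕ → ℕ → ℕ
Ψ f k t = Ψ-bits (f (f (2 * k)) ≡ᵇ 2 * k) (t ≡ᵇ f (2 * k)) f k t

toℕ-shift : ∀ {n} (x : Fin n) → suc (toℕ x) < n →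
  toℕ (if isEven (toℕ x) then prev x else next x) ≡ swapOdd (toℕ x)
toℕ-shift x p with isEven (toℕ x)
... | true = toℕ-prev x
... | false = toℕ-next x p

toℕ-ψ-bits : ∀ {n} b1 bx k (π : Fin n → Fin n) (x P Q : Fin n) →
  2 * k < n → toℕ P ≡ 2 * k → (b1 ≡ true → suc (2 * k) < n) → (b1 ≡ true → toℕ Q ≡ suc (2 * k)) →
  toℕ (ψ-bits b1 bx k π x P Q) ≡ Ψ-bits b1 bx (valℕ π) k (toℕ x)
toℕ-ψ-bits {n} false true k π x P Q k< eP eQ eQ2 with k ≡ᵇ 0
... | true = refl
... | false = toℕ-at (2 * k ∸ 1) x (≤-<-trans (m∸n≤m (2 * k) 1) k<)
toℕ-ψ-bits {n} false false k π x P Q k< eP eQ eQ2 with toℕ x ≡ᵇ 0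
... | true with k ≡ᵇ 0
...   | true = trans (sym (valℕ-toℕ π (π P))) (cong (valℕ π) (trans (sym (valℕ-toℕ π P)) (cong (valℕ π) eP)))
...   | false = refl
toℕ-ψ-bits {n} false false k π x P Q k< eP eQ eQ2 | false with toℕ x <ᵇ 2 * k ∸ 1 in e1
... | true = toℕ-shift x (≤-<-trans (≤-trans (<ᵇ⇒< _ _ (subst T (sym e1) tt)) (m∸n≤m (2 * k) 1)) k<)
... | false with toℕ x ≡ᵇ 2 * k ∸ 1
...   | true = trans (sym (valℕ-toℕ π P)) (cong (valℕ π) eP)
...   | false with toℕ x ≡ᵇ 2 * k
...     | true = trans (sym (valℕ-toℕ π (π P))) (cong (valℕ π) (trans (sym (valℕ-toℕ π P)) (cong (valℕ π) eP)))
...     | false = sym (valℕ-toℕ π x)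
toℕ-ψ-bits {n} true bx k π x P Q k< eP eQ eQ2 with toℕ x ≡ᵇ 0
... | true = refl
... | false with toℕ x <ᵇ suc (2 * k) in e1
...   | true = toℕ-shift x (≤-<-trans (<ᵇ⇒< _ _ (subst T (sym e1) tt)) (eQ refl))
...   | false with toℕ x ≡ᵇ suc (2 * k)
...     | true = trans (sym (valℕ-toℕ π P)) (cong (valℕ π) eP)
...     | false with bx
...       | true = trans (sym (valℕ-toℕ π Q)) (cong (valℕ π) (eQ2 refl))
...       | false = sym (valℕ-toℕ π x)

toℕ-ψ : ∀ {n} (π : Fin n → Fin n) (x : Fin n) → 2 * kOf π < n →
  (valℕ π (valℕ π (2 * kOf π)) ≡ 2 * kOf π → suc (2 * kOf π) < n) →
  toℕ (ψ π x) ≡ Ψ (valℕ π) (kOf π) (toℕ x)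
toℕ-ψ {n} π x k< hQ = trans (toℕ-ψ-bits b1 bx k π x P Q k< eP eQ eQ2) (cong₂ (λ u v → Ψ-bits u v f k (toℕ x)) e1 e2)
  where
  k : ℕ
  k = kOf π
  f : ℕ → ℕ
  f = valℕ π
  P : Fin n
  P = at (2 * k) x
  Q : Fin n
  Q = at (suc (2 * k)) x
  b1 : Bool
  b1 = ⌊ π (π P) FP.≟ P ⌋
  bx : Bool
  bx = ⌊ x FP.≟ π P ⌋
  eP : toℕ P ≡ 2 * k
  eP = toℕ-at (2 * k) x k<
  ePP : toℕ (π P) ≡ f (2 * k)
  ePP = trans (sym (valℕ-toℕ π P)) (cong f eP)
  e1 : b1 ≡ (f (f (2 * k)) ≡ᵇ 2 * k)
  e1 = trans (⌊≟⌋≡toℕ≡ᵇ (π (π P)) P) (cong₂ _≡ᵇ_ (trans (sym (valℕ-toℕ π (π P))) (cong f ePP)) eP)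
  e2 : bx ≡ (toℕ x ≡ᵇ f (2 * k))
  e2 = trans (⌊≟⌋≡toℕ≡ᵇ x (π P)) (cong (toℕ x ≡ᵇ_) ePP)
  eQ : b1 ≡ true → suc (2 * k) < n
  eQ b = hQ (≡ᵇtrue⇒≡ (trans (sym e1) b))
  eQ2 : b1 ≡ true → toℕ Q ≡ suc (2 * k)
  eQ2 b = toℕ-at (suc (2 * k)) x (eQ b)

countWhile : (ℕ → Bool) → ℕ → ℕ → ℕ
countWhile b zero m = m
countWhile b (suc fuel) m = if b m then countWhile b fuel (suc m) else m

countWhile-spec : ∀ b fuel m → m ≤ countWhile b fuel m × (∀ i → m ≤ i → i < countWhile b fuel m → b i ≡ true)
                  × (b (countWhile b fuel m) ≡ false ⊎ countWhile b fuel m ≡ fuel + m)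
countWhile-spec b zero m = ≤-refl , (λ i p q → ⊥-elim (<-irrefl refl (≤-<-trans p q))) , inj₂ refl
countWhile-spec b (suc fuel) m with b m in e
... | false = ≤-refl , (λ i p q → ⊥-elim (<-irrefl refl (≤-<-trans p q))) , inj₁ e
... | true with countWhile-spec b fuel (suc m)
...   | (a1 , a2 , a3) = ≤-trans (n≤1+n m) a1 , h , h3 a3
  where
  h : ∀ i → m ≤ i → i < countWhile b fuel (suc m) → b i ≡ true
  h i p q with m ≟ i
  ... | yes refl = e
  ... | no ne = a2 i (≤∧≢⇒< p ne) q
  h3 : b (countWhile b fuel (suc m)) ≡ false ⊎ countWhile b fuel (suc m) ≡ fuel + suc m →
       b (countWhile b fuel (suc m)) ≡ false ⊎ countWhile b fuel (suc m) ≡ suc fuel + m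
  h3 (inj₁ x) = inj₁ x
  h3 (inj₂ y) = inj₂ (trans y (+-suc fuel m))

countWhile-unique : ∀ b fuel k → (∀ i → i < k → b i ≡ true) → b k ≡ false → k ≤ fuel → countWhile b fuel 0 ≡ k
countWhile-unique b fuel k h hk k≤ with countWhile-spec b fuel 0
... | (_ , a2 , a3) with <-cmp (countWhile b fuel 0) k
...   | tri≈ _ e _ = e
...   | tri> _ _ k<c = ⊥-elim (true≢false (trans (sym (a2 k z≤n k<c)) hk))
...   | tri< lt _ _ with a3
...     | inj₁ x = ⊥-elim (true≢false (trans (sym (h _ lt)) x))
...     | inj₂ y = ⊥-elim (<-irrefl refl (≤-trans lt (≤-trans k≤ (≤-reflexive (sym (trans y (+-identityʳ fuel)))))))

countPairs≡countWhile : ∀ {n} (π : Fin n → Fin n) fuel m → countPairs π fuel m ≡ countWhile (pairAt π) fuel m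
countPairs≡countWhile π zero m = refl
countPairs≡countWhile π (suc fuel) m with pairAt π m
... | true = countPairs≡countWhile π fuel (suc m)
... | false = refl

pairAt-true⇒ : ∀ {n} (π : Fin n → Fin n) m → pairAt π m ≡ true →
  valℕ π (2 * m) ≡ suc (2 * m) × valℕ π (suc (2 * m)) ≡ 2 * m
pairAt-true⇒ π m e with ∧-true e
... | (a , b) = ≡ᵇtrue⇒≡ a , ≡ᵇtrue⇒≡ b

pairAt-false⇒ : ∀ {n} (π : Fin n → Fin n) m → pairAt π m ≡ false →
  ¬ (valℕ π (2 * m) ≡ suc (2 * m) × valℕ π (suc (2 * m)) ≡ 2 * m)
pairAt-false⇒ π m e (a , b) with ∧-false e
... | inj₁ x = true≢false (trans (sym (≡⇒≡ᵇtrue a)) x)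
... | inj₂ y = true≢false (trans (sym (≡⇒≡ᵇtrue b)) y)

⇒pairAt-true : ∀ {n} (π : Fin n → Fin n) m →
  valℕ π (2 * m) ≡ suc (2 * m) → valℕ π (suc (2 * m)) ≡ 2 * m → pairAt π m ≡ true
⇒pairAt-true π m a b rewrite ≡⇒≡ᵇtrue a | ≡⇒≡ᵇtrue b = refl

⇒pairAt-false₁ : ∀ {n} (π : Fin n → Fin n) m → valℕ π (2 * m) ≢ suc (2 * m) → pairAt π m ≡ false
⇒pairAt-false₁ π m a rewrite ≢⇒≡ᵇfalse a = refl

⇒pairAt-false₂ : ∀ {n} (π : Fin n → Fin n) m → valℕ π (suc (2 * m)) ≢ 2 * m → pairAt π m ≡ false
⇒pairAt-false₂ {n} π m b with valℕ π (2 * m) ≡ᵇ suc (2 * m)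
... | true rewrite ≢⇒≡ᵇfalse b = refl
... | false = refl

kOf-paired : ∀ {n} (π : Fin n → Fin n) i → i < kOf π →
  valℕ π (2 * i) ≡ suc (2 * i) × valℕ π (suc (2 * i)) ≡ 2 * i
kOf-paired {n} π i p =
  pairAt-true⇒ π i (proj₁ (proj₂ (countWhile-spec (pairAt π) n 0)) i z≤n (subst (i <_) (countPairs≡countWhile π n 0) p))

kOf-stops : ∀ {n} (π : Fin n → Fin n) → pairAt π (kOf π) ≡ false ⊎ kOf π ≡ n
kOf-stops {n} π rewrite countPairs≡countWhile π n 0 with proj₂ (proj₂ (countWhile-spec (pairAt π) n 0))
... | inj₁ x = inj₁ x
... | inj₂ y = inj₂ (trans y (+-identityʳ n))

-- Values of a map on Fin n stay below n, so valℕ π t = t+1 forces t+1 < n.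
valℕ≡suc⇒suc< : ∀ {n} (π : Fin n → Fin n) t → valℕ π t ≡ suc t → suc t < n
valℕ≡suc⇒suc< {n} π t e = helper (t <? n)
  where
  helper : Dec (t < n) → suc t < n
  helper (yes p) = subst (_< n) e (valℕ-< π t p)
  helper (no p) = ⊥-elim (n≢1+n t (trans (sym (valℕ-outside π t p)) e))

pairs⇒2*k≤n : ∀ {n} (π : Fin n → Fin n) k → (∀ i → i < k → valℕ π (2 * i) ≡ suc (2 * i)) → 2 * k ≤ n
pairs⇒2*k≤n π zero h = z≤n
pairs⇒2*k≤n {n} π (suc j) h = subst (_≤ n) (sym (2*suc j)) (valℕ≡suc⇒suc< π (2 * j) (h j (n<1+n j)))

swapEven-everywhere⇒pairing : ∀ {n} (π : Fin n → Fin n) k → 2 * k ≡ n →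
  (∀ t → t < 2 * k → valℕ π t ≡ swapEven t) → π ≗ pairing
swapEven-everywhere⇒pairing π k e below x = FP.toℕ-injective (begin
  toℕ (π x)          ≡⟨ valℕ-toℕ π x ⟨
  valℕ π (toℕ x)     ≡⟨ below (toℕ x) x<2k ⟩
  swapEven (toℕ x)   ≡⟨ toℕ-pairing x (subst (swapEven (toℕ x) <_) e (swapEven-< (toℕ x) k x<2k)) ⟨
  toℕ (pairing x)    ∎)
  where
  open ≡-Reasoning
  x<2k : toℕ x < 2 * k
  x<2k = subst (toℕ x <_) (sym e) (FP.toℕ<n x)

module OnIndices {n : ℕ} (π : Fin n → Fin n) (pp : IsPerm π) where
  f : ℕ → ℕ
  f = valℕ π
  fb : ∀ t → t < n → f t < n
  fb t p = valℕ-< π t p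
  fi : ∀ s t → s < n → t < n → f s ≡ f t → s ≡ t
  fi s t p q e = trans (sym (FP.toℕ-fromℕ< p)) (trans (cong toℕ (proj₁ pp (FP.toℕ-injective e'))) (FP.toℕ-fromℕ< q))
    where
    e' : toℕ (π (fromℕ< p)) ≡ toℕ (π (fromℕ< q))
    e' = trans (sym (valℕ-inside π s p)) (trans e (valℕ-inside π t q))
  fs : ∀ y → y < n → Σ ℕ λ u → u < n × f u ≡ y
  fs y p with proj₂ pp (fromℕ< p)
  ... | x , πx≡y = toℕ x , FP.toℕ<n x , trans (valℕ-toℕ π x) (trans (cong toℕ (πx≡y refl)) (FP.toℕ-fromℕ< p))

derangement-on-indices : ∀ {n} (π : Fin n → Fin n) → IsDerangement π → ∀ t → t < n → valℕ π t ≢ t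
derangement-on-indices π d t p e = d (fromℕ< p) (FP.toℕ-injective (trans (sym (valℕ-inside π t p)) (trans e (sym (FP.toℕ-fromℕ< p)))))

prefix-of-D* : ∀ {n} (π : Fin n → Fin n) → 1 ≤ n → DStar n π →
   2 * kOf π < n × (∀ t → t < 2 * kOf π → valℕ π t ≡ swapEven t)
   × ¬ (valℕ π (2 * kOf π) ≡ suc (2 * kOf π) × valℕ π (suc (2 * kOf π)) ≡ 2 * kOf π)
prefix-of-D* {n} π n1 (_ , ≢pairing) = 2k<n , below , notPaired
  where
  k : ℕ
  k = kOf π
  2k≤n : 2 * k ≤ n
  2k≤n = pairs⇒2*k≤n π k (λ i p → proj₁ (kOf-paired π i p))
  below : ∀ t → t < 2 * k → valℕ π t ≡ swapEven t
  below = pairs⇒below (λ t → valℕ π t ≡ swapEven t) k λ i p →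
    trans (proj₁ (kOf-paired π i p)) (sym (swapEven-even i)) , trans (proj₂ (kOf-paired π i p)) (sym (swapEven-odd i))
  -- the count cannot run out of fuel, since 2n ≤ n fails for n ≥ 1
  notPaired : ¬ (valℕ π (2 * k) ≡ suc (2 * k) × valℕ π (suc (2 * k)) ≡ 2 * k)
  notPaired with kOf-stops π
  ... | inj₁ x = pairAt-false⇒ π k x
  ... | inj₂ k≡n = ⊥-elim (<⇒≱ n<2n (subst (λ w → 2 * w ≤ n) k≡n 2k≤n))
    where
    n<2n : n < 2 * n
    n<2n = subst (n <_) (cong (n +_) (sym (+-identityʳ n))) (m<m+n n n1)
  -- 2k = n would make π the excluded involution (1,2)(3,4)⋯
  2k<n : 2 * k < n
  2k<n = ≤∧≢⇒< 2k≤n λ e → ≢pairing (subst (2 ∣_) e (2∣2*k k)) (swapEven-everywhere⇒pairing π k e below)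

-- Case (i): the cycle of index 2k has at least three elements.
module Ψ-CaseI (f : ℕ → ℕ) (k : ℕ) (ne : f (f (2 * k)) ≢ 2 * k) where
  A : ℕ
  A = f (2 * k)

  I-A : Ψ f k A ≡ (if k ≡ᵇ 0 then A else 2 * k ∸ 1)
  I-A rewrite ≢⇒≡ᵇfalse ne | ≡⇒≡ᵇtrue {A} refl = refl

  I-0 : 0 ≢ A → Ψ f k 0 ≡ (if k ≡ᵇ 0 then f A else 0)
  I-0 p rewrite ≢⇒≡ᵇfalse ne | ≢⇒≡ᵇfalse p = refl

  I-low : ∀ t → t ≢ A → t ≢ 0 → t < 2 * k ∸ 1 → Ψ f k t ≡ swapOdd t
  I-low t p q r rewrite ≢⇒≡ᵇfalse ne | ≢⇒≡ᵇfalse p | ≢⇒≡ᵇfalse q | <⇒<ᵇtrue r = refl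

  I-m1 : k ≢ 0 → 2 * k ∸ 1 ≢ A → Ψ f k (2 * k ∸ 1) ≡ A
  I-m1 k≠0 p rewrite ≢⇒≡ᵇfalse ne | ≢⇒≡ᵇfalse p | ≢⇒≡ᵇfalse {2 * k ∸ 1} {0} (2*k∸1≢0 k k≠0)
    | ≮⇒<ᵇfalse (<-irrefl {2 * k ∸ 1} refl) | ≡⇒≡ᵇtrue {2 * k ∸ 1} refl = refl

  I-2k : 2 * k ≢ A → Ψ f k (2 * k) ≡ f A
  I-2k p with k ≟ 0
  ... | yes e rewrite ≢⇒≡ᵇfalse ne | ≢⇒≡ᵇfalse p | ≡⇒≡ᵇtrue {2 * k} {0} (cong (2 *_) e) | ≡⇒≡ᵇtrue {k} {0} e = refl
  ... | no e rewrite ≢⇒≡ᵇfalse ne | ≢⇒≡ᵇfalse p | ≢⇒≡ᵇfalse {2 * k} {0} (λ x → e (2*k≡0⇒k≡0 k x))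
    | ≮⇒<ᵇfalse {2 * k} {2 * k ∸ 1} (λ q → <-asym q (2*k∸1<2*k k e))
    | ≢⇒≡ᵇfalse {2 * k} {2 * k ∸ 1} (λ q → <-irrefl (sym q) (2*k∸1<2*k k e)) | ≡⇒≡ᵇtrue {2 * k} refl = refl

  I-rest : ∀ t → 2 * k < t → t ≢ A → Ψ f k t ≡ f t
  I-rest t p q rewrite ≢⇒≡ᵇfalse ne | ≢⇒≡ᵇfalse q
    | ≢⇒≡ᵇfalse {t} {0} (λ e → ≤⇒≯ z≤n (subst (2 * k <_) e p))
    | ≮⇒<ᵇfalse {t} {2 * k ∸ 1} (λ r → <-irrefl refl (<-trans p (<-≤-trans r (m∸n≤m (2 * k) 1))))
    | ≢⇒≡ᵇfalse {t} {2 * k ∸ 1} (λ e → <-irrefl refl (≤-<-trans (≤-reflexive e) (≤-<-trans (m∸n≤m (2 * k) 1) p)))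
    | ≢⇒≡ᵇfalse {t} {2 * k} (λ e → <-irrefl (sym e) p)
    = refl

-- Case (ii): index 2k lies in the 2-cycle (2k, a₁).
module Ψ-CaseII (f : ℕ → ℕ) (k : ℕ) (e : f (f (2 * k)) ≡ 2 * k) where
  A : ℕ
  A = f (2 * k)

  II-0 : Ψ f k 0 ≡ 0
  II-0 rewrite ≡⇒≡ᵇtrue e = refl

  II-low : ∀ t → 1 ≤ t → t < suc (2 * k) → Ψ f k t ≡ swapOdd t
  II-low t p q rewrite ≡⇒≡ᵇtrue e | ≢⇒≡ᵇfalse {t} {0} (λ x → <-irrefl (sym x) p) | <⇒<ᵇtrue q = refl

  II-Q : Ψ f k (suc (2 * k)) ≡ A
  II-Q rewrite ≡⇒≡ᵇtrue e | ≮⇒<ᵇfalse (<-irrefl {suc (2 * k)} refl) | ≡⇒≡ᵇtrue {suc (2 * k)} refl = refl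

  II-A : suc (2 * k) < A → Ψ f k A ≡ f (suc (2 * k))
  II-A p rewrite ≡⇒≡ᵇtrue e | ≢⇒≡ᵇfalse {A} {0} (λ x → <-irrefl (sym x) (≤-<-trans z≤n p))
    | ≮⇒<ᵇfalse {A} {suc (2 * k)} (<-asym p) | ≢⇒≡ᵇfalse {A} {suc (2 * k)} (λ x → <-irrefl (sym x) p) | ≡⇒≡ᵇtrue {A} refl = refl

  II-rest : ∀ t → suc (2 * k) < t → t ≢ A → Ψ f k t ≡ f t
  II-rest t p q rewrite ≡⇒≡ᵇtrue e | ≢⇒≡ᵇfalse {t} {0} (λ x → <-irrefl (sym x) (≤-<-trans z≤n p))
    | ≮⇒<ᵇfalse {t} {suc (2 * k)} (<-asym p) | ≢⇒≡ᵇfalse {t} {suc (2 * k)} (λ x → <-irrefl (sym x) p) | ≢⇒≡ᵇfalse q = refl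

-- The shape records which case of ψ can produce
-- σ, together with the parameter needed to undo it:
--   caseI₀ c : the fixed point is c ≠ 0 (case (i) with k = 0);
--   caseI₊ k : the fixed point is 0, σ pairs 2j+1 ↔ 2j+2 for j < k−1 and
--              2k−1 lies in a 2-cycle (case (i) with k ≥ 1);
--   caseII m : the fixed point is 0, σ pairs 2j+1 ↔ 2j+2 for j < m and
--              2m+1 lies in a longer cycle (case (ii) with k = m).
data Shape : Set where
  caseI₀ : ℕ → Shape
  caseI₊ : ℕ → Shape
  caseII : ℕ → Shape

-- The inverse of ψ on each shape (on indices): unψ s (ψ π) = π.
unψ : Shape → (ℕ → ℕ) → ℕ → ℕ
unψ (caseI₀ c) g t = if t ≡ᵇ 0 then c else if t ≡ᵇ c then g 0 else g t
unψ (caseI₊ k) g t = if t <ᵇ 2 * k then swapEven t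
               else if t ≡ᵇ 2 * k then g (2 * k ∸ 1)
               else if t ≡ᵇ g (2 * k ∸ 1) then g (2 * k)
               else g t
unψ (caseII m) g t = if t <ᵇ 2 * m then swapEven t
               else if t ≡ᵇ 2 * m then g (suc (2 * m))
               else if t ≡ᵇ suc (2 * m) then g (g (suc (2 * m)))
               else if t ≡ᵇ g (suc (2 * m)) then 2 * m
               else g t

PairedUpTo : (ℕ → ℕ) → ℕ → Set
PairedUpTo g m = (∀ j → j < m → g (suc (2 * j)) ≡ suc (suc (2 * j)) × g (suc (suc (2 * j))) ≡ suc (2 * j))
          × ¬ (g (suc (2 * m)) ≡ suc (suc (2 * m)) × g (suc (suc (2 * m))) ≡ suc (2 * m))

HasShape : ℕ → (ℕ → ℕ) → Shape → Set
HasShape n g (caseI₀ c) = g 0 ≢ 0 × g c ≡ c × c < n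
HasShape n g (caseI₊ k) = k ≢ 0 × g 0 ≡ 0 × PairedUpTo g (k ∸ 1) × g (g (2 * k ∸ 1)) ≡ 2 * k ∸ 1
HasShape n g (caseII m) = g 0 ≡ 0 × PairedUpTo g m × g (g (suc (2 * m))) ≢ suc (2 * m)

1+2*pred : ∀ k → k ≢ 0 → suc (2 * (k ∸ 1)) ≡ 2 * k ∸ 1
1+2*pred zero z = ⊥-elim (z refl)
1+2*pred (suc k) z = sym (+-suc k (k + 0))

2+2*pred : ∀ k → k ≢ 0 → suc (suc (2 * (k ∸ 1))) ≡ 2 * k
2+2*pred zero z = ⊥-elim (z refl)
2+2*pred (suc k) z = sym (2*suc k)

1+[2*k∸1] : ∀ k → k ≢ 0 → suc (2 * k ∸ 1) ≡ 2 * k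
1+[2*k∸1] k z = trans (cong suc (sym (1+2*pred k z))) (2+2*pred k z)

∸1-injective : ∀ k k' → k ≢ 0 → k' ≢ 0 → k ∸ 1 ≡ k' ∸ 1 → k ≡ k'
∸1-injective zero _ z _ _ = ⊥-elim (z refl)
∸1-injective (suc k) zero _ z _ = ⊥-elim (z refl)
∸1-injective (suc k) (suc k') _ _ e = cong suc e

PairedUpTo-unique : ∀ g m m' → PairedUpTo g m → PairedUpTo g m' → m ≡ m'
PairedUpTo-unique g m m' (a , b) (a' , b') with <-cmp m m'
... | tri< lt _ _ = ⊥-elim (b (a' m lt))
... | tri≈ _ eq _ = eq
... | tri> _ _ m>m′ = ⊥-elim (b' (a m' m>m′))

-- A map with at most one fixed point has at most one shape: the fixed point
-- separates caseI₀ from the others, the first failure m and whether 2m+1 is in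
-- a 2-cycle separate caseI₊ from caseII.
HasShape-unique : ∀ n g → (∀ a b → a < n → b < n → g a ≡ a → g b ≡ b → a ≡ b) →
  ∀ s s' → HasShape n g s → HasShape n g s' → s ≡ s'
HasShape-unique n g u (caseI₀ c) (caseI₀ c') (_ , x , p) (_ , x' , p') = cong caseI₀ (u c c' p p' x x')
HasShape-unique n g u (caseI₀ c) (caseI₊ m) (x , _) (_ , y , _) = ⊥-elim (x y)
HasShape-unique n g u (caseI₀ c) (caseII m) (x , _) (y , _) = ⊥-elim (x y)
HasShape-unique n g u (caseI₊ m) (caseI₀ c) (_ , y , _) (x , _) = ⊥-elim (x y)
HasShape-unique n g u (caseII m) (caseI₀ c) (y , _) (x , _) = ⊥-elim (x y)
HasShape-unique n g u (caseI₊ m) (caseI₊ m') (z , _ , a , _) (z' , _ , a' , _) = cong caseI₊ (∸1-injective m m' z z' (PairedUpTo-unique g _ _ a a'))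
HasShape-unique n g u (caseII m) (caseII m') (_ , a , _) (_ , a' , _) = cong caseII (PairedUpTo-unique g m m' a a')
HasShape-unique n g u (caseI₊ m) (caseII m') (z , _ , a , c) (_ , a' , c') with PairedUpTo-unique g _ m' a a'
... | refl = ⊥-elim (c' (subst (λ w → g (g w) ≡ w) (sym (1+2*pred m z)) c))
HasShape-unique n g u (caseII m) (caseI₊ m') (_ , a , c) (z , _ , a' , c') with PairedUpTo-unique g m _ a a'
... | refl = ⊥-elim (c (subst (λ w → g (g w) ≡ w) (sym (1+2*pred m' z)) c'))

module unψ-I₀ (c : ℕ) (g : ℕ → ℕ) where
  at-c : c ≢ 0 → unψ (caseI₀ c) g c ≡ g 0
  at-c p rewrite ≢⇒≡ᵇfalse p | ≡⇒≡ᵇtrue {c} refl = refl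
  elsewhere : ∀ t → t ≢ 0 → t ≢ c → unψ (caseI₀ c) g t ≡ g t
  elsewhere t p q rewrite ≢⇒≡ᵇfalse p | ≢⇒≡ᵇfalse q = refl

module unψ-I₊ (k : ℕ) (g : ℕ → ℕ) where
  A : ℕ
  A = g (2 * k ∸ 1)
  below : ∀ t → t < 2 * k → unψ (caseI₊ k) g t ≡ swapEven t
  below t p rewrite <⇒<ᵇtrue p = refl
  at-2k : unψ (caseI₊ k) g (2 * k) ≡ A
  at-2k rewrite ≮⇒<ᵇfalse (<-irrefl {2 * k} refl) | ≡⇒≡ᵇtrue {2 * k} refl = refl
  at-A : 2 * k < A → unψ (caseI₊ k) g A ≡ g (2 * k)
  at-A p rewrite ≮⇒<ᵇfalse (<-asym p) | ≢⇒≡ᵇfalse {A} {2 * k} (λ x → <-irrefl (sym x) p) | ≡⇒≡ᵇtrue {A} refl = refl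
  elsewhere : ∀ t → 2 * k < t → t ≢ A → unψ (caseI₊ k) g t ≡ g t
  elsewhere t p q rewrite ≮⇒<ᵇfalse (<-asym p) | ≢⇒≡ᵇfalse {t} {2 * k} (λ x → <-irrefl (sym x) p) | ≢⇒≡ᵇfalse q = refl

module unψ-II (m : ℕ) (g : ℕ → ℕ) where
  A : ℕ
  A = g (suc (2 * m))
  below : ∀ t → t < 2 * m → unψ (caseII m) g t ≡ swapEven t
  below t p rewrite <⇒<ᵇtrue p = refl
  at-2k : unψ (caseII m) g (2 * m) ≡ A
  at-2k rewrite ≮⇒<ᵇfalse (<-irrefl {2 * m} refl) | ≡⇒≡ᵇtrue {2 * m} refl = refl
  at-Q : unψ (caseII m) g (suc (2 * m)) ≡ g A
  at-Q rewrite ≮⇒<ᵇfalse {suc (2 * m)} {2 * m} (λ x → <-irrefl refl (<-trans (n<1+n _) x))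
    | ≢⇒≡ᵇfalse {suc (2 * m)} {2 * m} (λ x → n≢1+n _ (sym x)) | ≡⇒≡ᵇtrue {suc (2 * m)} refl = refl
  at-A : suc (2 * m) < A → unψ (caseII m) g A ≡ 2 * m
  at-A p rewrite ≮⇒<ᵇfalse {A} {2 * m} (λ x → <-asym p (<-trans x (n<1+n _)))
    | ≢⇒≡ᵇfalse {A} {2 * m} (λ x → <-asym p (subst (_< suc (2 * m)) (sym x) (n<1+n _)))
    | ≢⇒≡ᵇfalse {A} {suc (2 * m)} (λ x → <-irrefl (sym x) p) | ≡⇒≡ᵇtrue {A} refl = refl
  elsewhere : ∀ t → suc (2 * m) < t → t ≢ A → unψ (caseII m) g t ≡ g t
  elsewhere t p q rewrite ≮⇒<ᵇfalse {t} {2 * m} (λ x → <-asym p (<-trans x (n<1+n _)))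
    | ≢⇒≡ᵇfalse {t} {2 * m} (λ x → <-asym p (subst (_< suc (2 * m)) (sym x) (n<1+n _)))
    | ≢⇒≡ᵇfalse {t} {suc (2 * m)} (λ x → <-irrefl (sym x) p) | ≢⇒≡ᵇfalse q = refl

≮∧≢⇒> : ∀ {a t} → ¬ t < a → t ≢ a → a < t
≮∧≢⇒> p q = ≤∧≢⇒< (≮⇒≥ p) (λ e → q (sym e))

SurjectiveBelow : ℕ → (ℕ → ℕ) → Set
SurjectiveBelow n g = ∀ y → y < n → Σ ℕ λ t → t < n × g t ≡ y

UniqueFixedPoint : ℕ → (ℕ → ℕ) → Set
UniqueFixedPoint n g = Σ ℕ λ c → c < n × g c ≡ c × (∀ t → t < n → g t ≡ t → t ≡ c)

Unlike-pairing′ : ℕ → (ℕ → ℕ) → Set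
Unlike-pairing′ n g = Σ ℕ λ t → t < n × ((t ≡ 0 × g t ≢ 0) ⊎ (t ≢ 0 × swapOdd t < n × g t ≢ swapOdd t))

RecoveredFrom : ℕ → (ℕ → ℕ) → (ℕ → ℕ) → Set
RecoveredFrom n f g = Σ Shape λ s → HasShape n g s × (∀ t → t < n → f t ≡ unψ s g t)

module ImageOfD (n : ℕ) (f : ℕ → ℕ)
  (fb : ∀ t → t < n → f t < n)
  (fi : ∀ s t → s < n → t < n → f s ≡ f t → s ≡ t)
  (fs : ∀ y → y < n → Σ ℕ λ u → u < n × f u ≡ y)
  (fd : ∀ t → t < n → f t ≢ t)
  (k : ℕ) (k< : 2 * k < n)
  (H1 : ∀ t → t < 2 * k → f t ≡ swapEven t)
  (H2 : ¬ (f (2 * k) ≡ suc (2 * k) × f (suc (2 * k)) ≡ 2 * k)) where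

  -- f permutes [0, 2k), so only points below 2k are mapped below 2k.
  low : ∀ t → t < n → f t < 2 * k → t < 2 * k
  low t t<n p = subst (_< 2 * k) e (swapEven-< (f t) k p)
    where
    swy< : swapEven (f t) < 2 * k
    swy< = swapEven-< (f t) k p
    e : swapEven (f t) ≡ t
    e = fi (swapEven (f t)) t (<-trans swy< k<) t<n (trans (H1 (swapEven (f t)) swy<) (swapEven-involutive (f t)))

  lowf : ∀ t → t < 2 * k → f t < 2 * k
  lowf t p = subst (_< 2 * k) (sym (H1 t p)) (swapEven-< t k p)

  0<n : 0 < n
  0<n = ≤-<-trans z≤n k<

  A : ℕ
  A = f (2 * k)
  A<n : A < n
  A<n = fb (2 * k) k<
  kA : 2 * k < A
  kA = ≤∧≢⇒< (≮⇒≥ (λ q → <-irrefl refl (low (2 * k) k< q))) (λ e → fd (2 * k) k< (sym e))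

  QA : f A ≡ 2 * k → suc (2 * k) < A
  QA e = ≤∧≢⇒< kA (λ x → H2 (sym x , subst (λ z → f z ≡ 2 * k) (sym x) e))

  Qok : f A ≡ 2 * k → suc (2 * k) < n
  Qok e = <-trans (QA e) A<n

  -- g is any map agreeing with Ψ f k on [0, n), such as valℕ (ψ π).
  module Image (g : ℕ → ℕ) (gΨ : ∀ t → t < n → g t ≡ Ψ f k t) where

    module CaseI (ne : f A ≢ 2 * k) where
      open Ψ-CaseI f k ne using (I-A; I-0; I-low; I-m1; I-2k; I-rest)
      B : ℕ
      B = f A
      kB : 2 * k < B
      kB = ≤∧≢⇒< (≮⇒≥ (λ q → <-asym kA (low A A<n q))) (λ x → ne (sym x))
      0≢A : 0 ≢ A
      0≢A x = <-irrefl x (≤-<-trans z≤n kA)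
      m1<n : 2 * k ∸ 1 < n
      m1<n = ≤-<-trans (m∸n≤m (2 * k) 1) k<
      m1<A : 2 * k ∸ 1 < A
      m1<A = ≤-<-trans (m∸n≤m (2 * k) 1) kA

      gA : g A ≡ (if k ≡ᵇ 0 then A else 2 * k ∸ 1)
      gA = trans (gΨ A A<n) I-A
      gA0 : k ≡ 0 → g A ≡ A
      gA0 z = trans gA (cong (λ b → if b then A else 2 * k ∸ 1) (≡⇒≡ᵇtrue z))
      gA1 : k ≢ 0 → g A ≡ 2 * k ∸ 1
      gA1 z = trans gA (cong (λ b → if b then A else 2 * k ∸ 1) (≢⇒≡ᵇfalse z))
      g0 : g 0 ≡ (if k ≡ᵇ 0 then B else 0)
      g0 = trans (gΨ 0 0<n) (I-0 0≢A)
      g00 : k ≡ 0 → g 0 ≡ B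
      g00 z = trans g0 (cong (λ b → if b then B else 0) (≡⇒≡ᵇtrue z))
      g01 : k ≢ 0 → g 0 ≡ 0
      g01 z = trans g0 (cong (λ b → if b then B else 0) (≢⇒≡ᵇfalse z))
      glow : ∀ t → t ≢ 0 → t < 2 * k ∸ 1 → g t ≡ swapOdd t
      glow t p q = trans (gΨ t (<-trans q m1<n)) (I-low t (λ x → <-irrefl x (<-trans q m1<A)) p q)
      gm1 : k ≢ 0 → g (2 * k ∸ 1) ≡ A
      gm1 z = trans (gΨ _ m1<n) (I-m1 z (<⇒≢ m1<A))
      g2k : g (2 * k) ≡ B
      g2k = trans (gΨ _ k<) (I-2k (<⇒≢ kA))
      grest : ∀ t → t < n → 2 * k < t → t ≢ A → g t ≡ f t
      grest t p q r = trans (gΨ t p) (I-rest t q r)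
      fk0 : k ≡ 0 → f 0 ≡ A
      fk0 z = cong f (sym (cong (2 *_) z))

      -- Every index is hit: the prefix, a₁ and a₂ explicitly, the rest through f.
      onto : SurjectiveBelow n g
      onto y y<n with y ≟ A
      ... | yes refl with k ≟ 0
      ...   | yes z = A , A<n , gA0 z
      ...   | no z = 2 * k ∸ 1 , m1<n , gm1 z
      onto y y<n | no yA with y ≟ B
      ... | yes refl = 2 * k , k< , g2k
      ... | no yB with y <? 2 * k
      ...   | no y≮ = u , u<n , trans (grest u u<n (≮∧≢⇒> u≮ u≢) (λ x → yB (trans (sym fu) (trans (cong f x) refl)))) fu
        where
        u : ℕ
        u = proj₁ (fs y y<n)
        u<n : u < n
        u<n = proj₁ (proj₂ (fs y y<n))
        fu : f u ≡ y
        fu = proj₂ (proj₂ (fs y y<n))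
        u≮ : ¬ u < 2 * k
        u≮ q = y≮ (subst (_< 2 * k) fu (lowf u q))
        u≢ : u ≢ 2 * k
        u≢ x = yA (trans (sym fu) (cong f x))
      ...   | yes y< with k ≟ 0
      ...     | yes z = ⊥-elim (≤⇒≯ z≤n (subst (λ w → y < 2 * w) z y<))
      ...     | no z with y ≟ 0
      ...       | yes refl = 0 , 0<n , g01 z
      ...       | no y0 with y ≟ 2 * k ∸ 1
      ...         | yes refl = A , A<n , gA1 z
      ...         | no ym = swapOdd y , <-trans s< m1<n , trans (glow (swapOdd y) (λ x → <-irrefl (sym x) (proj₁ rg)) s<) (swapOdd-involutive y y1)
        where
        y1 : 1 ≤ y
        y1 = ≤∧≢⇒< z≤n (λ x → y0 (sym x))
        y<m : y < 2 * k ∸ 1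
        y<m = ≤∧≢⇒< (≤-pred (subst (y <_) (sym (1+[2*k∸1] k z)) y<)) ym
        rg : 1 ≤ swapOdd y × swapOdd y < suc (2 * (k ∸ 1))
        rg = swapOdd-range y (k ∸ 1) y1 (subst (y <_) (sym (1+2*pred k z)) y<m)
        s< : swapOdd y < 2 * k ∸ 1
        s< = subst (swapOdd y <_) (1+2*pred k z) (proj₂ rg)

      -- The only fixed point is a₁ (k = 0) or 0 (k ≥ 1).
      uniqueFixed : UniqueFixedPoint n g
      uniqueFixed with k ≟ 0
      ... | yes z = A , A<n , gA0 z , u
        where
        u : ∀ t → t < n → g t ≡ t → t ≡ A
        u t p q with t ≟ A
        ... | yes e = e
        ... | no tA with t ≟ 0
        ...   | yes refl = ⊥-elim (<-irrefl (sym (trans (sym (g00 z)) q)) (≤-<-trans z≤n kB))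
        ...   | no t0 = ⊥-elim (fd t p (trans (sym (grest t p (subst (λ w → 2 * w < t) (sym z) (≤∧≢⇒< z≤n (λ x → t0 (sym x)))) tA)) q))
      ... | no z = 0 , 0<n , g01 z , u
        where
        u : ∀ t → t < n → g t ≡ t → t ≡ 0
        u t p q with t ≟ 0
        ... | yes e = e
        ... | no t0 with t ≟ A
        ...   | yes refl = ⊥-elim (<-irrefl (sym (trans (sym q) (gA1 z))) m1<A)
        ...   | no tA with t <? 2 * k ∸ 1
        ...     | yes tl = ⊥-elim (swapOdd-no-fixed t (≤∧≢⇒< z≤n (λ x → t0 (sym x))) (trans (sym (glow t t0 tl)) q))
        ...     | no tl with t ≟ 2 * k ∸ 1
        ...       | yes refl = ⊥-elim (<-irrefl (trans (sym q) (gm1 z)) m1<A)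
        ...       | no tm with t ≟ 2 * k
        ...         | yes refl = ⊥-elim (<-irrefl (trans (sym q) g2k) kB)
        ...         | no t2 = ⊥-elim (fd t p (trans (sym (grest t p k<t tA)) q))
          where
          k<t : 2 * k < t
          k<t = ≤∧≢⇒< (subst (_≤ t) (1+[2*k∸1] k z) (≮∧≢⇒> tl tm)) (λ x → t2 (sym x))

      -- g is not (1)(2,3)⋯: it differs at 0 (k = 0) or at 2k−1 (k ≥ 1).
      unlike′ : Unlike-pairing′ n g
      unlike′ with k ≟ 0
      ... | yes z = 0 , 0<n , inj₁ (refl , λ x → <-irrefl (sym (trans (sym (g00 z)) x)) (≤-<-trans z≤n kB))
      ... | no z = 2 * k ∸ 1 , m1<n , inj₂ (2*k∸1≢0 k z , subst (_< n) (sym sw2m) k< ,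
                    λ x → <-irrefl (sym (trans (sym (gm1 z)) (trans x sw2m))) kA)
        where
        sw2m : swapOdd (2 * k ∸ 1) ≡ 2 * k
        sw2m = trans (cong swapOdd (sym (1+2*pred k z))) (trans (swapOdd-odd (k ∸ 1)) (2+2*pred k z))

      recovered : RecoveredFrom n f g
      recovered with k ≟ 0
      ... | yes z = caseI₀ A , ((λ x → <-irrefl (sym (trans (sym (g00 z)) x)) (≤-<-trans z≤n kB)) , gA0 z , A<n) , r
        where
        r : ∀ t → t < n → f t ≡ unψ (caseI₀ A) g t
        r t p with t ≟ 0
        ... | yes refl = fk0 z
        ... | no t0 with t ≟ A
        ...   | yes refl = trans (sym (g00 z)) (sym (unψ-I₀.at-c A g (λ x → 0≢A (sym x))))
        ...   | no tA = trans (sym (grest t p (subst (λ w → 2 * w < t) (sym z) (≤∧≢⇒< z≤n (λ x → t0 (sym x)))) tA))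
                             (sym (unψ-I₀.elsewhere A g t t0 tA))
      ... | no z = caseI₊ k , (z , g01 z , (ms1 , ms2) , trans (cong g (gm1 z)) (gA1 z)) , r
        where
        ms1 : ∀ j → j < k ∸ 1 → g (suc (2 * j)) ≡ suc (suc (2 * j)) × g (suc (suc (2 * j))) ≡ suc (2 * j)
        ms1 j j< = trans (glow _ (λ ()) l1) (swapOdd-odd j) , trans (glow _ (λ ()) l2) (swapOdd-even j)
          where
          l2' : suc (suc (2 * j)) ≤ 2 * (k ∸ 1)
          l2' = subst (_≤ 2 * (k ∸ 1)) (2*suc j) (*-monoʳ-≤ 2 j<)
          l2 : suc (suc (2 * j)) < 2 * k ∸ 1
          l2 = subst (suc (suc (2 * j)) <_) (1+2*pred k z) (s≤s l2')
          l1 : suc (2 * j) < 2 * k ∸ 1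
          l1 = <-trans (n<1+n _) l2
        ms2 : ¬ (g (suc (2 * (k ∸ 1))) ≡ suc (suc (2 * (k ∸ 1))) × g (suc (suc (2 * (k ∸ 1)))) ≡ suc (2 * (k ∸ 1)))
        ms2 (x , _) = <-irrefl (sym (trans (sym (gm1 z)) (trans (sym (cong g (1+2*pred k z))) (trans x (2+2*pred k z))))) kA
        r : ∀ t → t < n → f t ≡ unψ (caseI₊ k) g t
        r t p with t <? 2 * k
        ... | yes tl = trans (H1 t tl) (sym (unψ-I₊.below k g t tl))
        ... | no tl with t ≟ 2 * k
        ...   | yes refl = trans (sym (gm1 z)) (sym (unψ-I₊.at-2k k g))
        ...   | no t2 with t ≟ A
        ...     | yes refl = trans (sym g2k) (sym (subst (λ w → unψ (caseI₊ k) g w ≡ g (2 * k)) (gm1 z) (unψ-I₊.at-A k g (subst (2 * k <_) (sym (gm1 z)) kA))))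
        ...     | no tA = trans (sym (grest t p (≮∧≢⇒> tl t2) tA)) (sym (unψ-I₊.elsewhere k g t (≮∧≢⇒> tl t2) (λ x → tA (trans x (gm1 z)))))

    module CaseII (e : f A ≡ 2 * k) where
      open Ψ-CaseII f k e using (II-0; II-low; II-Q; II-A; II-rest)
      Q : ℕ
      Q = suc (2 * k)
      QA' : Q < A
      QA' = QA e
      Q<n : Q < n
      Q<n = Qok e
      C : ℕ
      C = f Q
      CQ : C ≢ Q
      CQ = fd Q Q<n
      CA : C ≢ A
      CA x = n≢1+n (2 * k) (sym (fi Q (2 * k) Q<n k< x))

      g0 : g 0 ≡ 0
      g0 = trans (gΨ 0 0<n) II-0
      glow : ∀ t → 1 ≤ t → t < Q → g t ≡ swapOdd t
      glow t p q = trans (gΨ t (<-trans q Q<n)) (II-low t p q)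
      gQ : g Q ≡ A
      gQ = trans (gΨ Q Q<n) II-Q
      gA : g A ≡ C
      gA = trans (gΨ A A<n) (II-A QA')
      grest : ∀ t → t < n → Q < t → t ≢ A → g t ≡ f t
      grest t p q r = trans (gΨ t p) (II-rest t q r)

      -- The prefix, a₁ and C are hit explicitly, the rest through f.
      onto : SurjectiveBelow n g
      onto y y<n with y <? Q
      ... | yes yl with y ≟ 0
      ...   | yes refl = 0 , 0<n , g0
      ...   | no y0 = swapOdd y , <-trans (proj₂ rg) Q<n , trans (glow (swapOdd y) (proj₁ rg) (proj₂ rg)) (swapOdd-involutive y y1)
        where
        y1 : 1 ≤ y
        y1 = ≤∧≢⇒< z≤n (λ x → y0 (sym x))
        rg : 1 ≤ swapOdd y × swapOdd y < suc (2 * k)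
        rg = swapOdd-range y k y1 yl
      onto y y<n | no yl with y ≟ A
      ... | yes refl = Q , Q<n , gQ
      ... | no yA with y ≟ C
      ...   | yes refl = A , A<n , gA
      ...   | no yC = u , u<n , trans (grest u u<n Qu uA) fu
        where
        u : ℕ
        u = proj₁ (fs y y<n)
        u<n : u < n
        u<n = proj₁ (proj₂ (fs y y<n))
        fu : f u ≡ y
        fu = proj₂ (proj₂ (fs y y<n))
        u≮ : ¬ u < 2 * k
        u≮ q = yl (<-trans (subst (_< 2 * k) fu (lowf u q)) (n<1+n _))
        u2 : u ≢ 2 * k
        u2 x = yA (trans (sym fu) (cong f x))
        uQ : u ≢ Q
        uQ x = yC (trans (sym fu) (cong f x))
        Qu : Q < u
        Qu = ≤∧≢⇒< (≤∧≢⇒< (≮⇒≥ u≮) (λ x → u2 (sym x))) (λ x → uQ (sym x))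
        uA : u ≢ A
        uA x = yl (subst (_< Q) (trans (sym e) (trans (cong f (sym x)) fu)) (n<1+n _))

      uniqueFixed : UniqueFixedPoint n g
      uniqueFixed = 0 , 0<n , g0 , u
        where
        u : ∀ t → t < n → g t ≡ t → t ≡ 0
        u t p q with t ≟ 0
        ... | yes x = x
        ... | no t0 with t <? Q
        ...   | yes tl = ⊥-elim (swapOdd-no-fixed t (≤∧≢⇒< z≤n (λ x → t0 (sym x))) (trans (sym (glow t (≤∧≢⇒< z≤n (λ x → t0 (sym x))) tl)) q))
        ...   | no tl with t ≟ Q
        ...     | yes refl = ⊥-elim (<-irrefl (trans (sym q) gQ) QA')
        ...     | no tQ with t ≟ A
        ...       | yes refl = ⊥-elim (CA (trans (sym gA) q))
        ...       | no tA = ⊥-elim (fd t p (trans (sym (grest t p (≮∧≢⇒> tl tQ) tA)) q))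

      -- g differs from (1)(2,3)⋯ at 2k+1 unless a₁ = 2k+2, and then at a₁.
      unlike′ : Unlike-pairing′ n g
      unlike′ with A ≟ suc Q
      ... | no ne2 = Q , Q<n , inj₂ ((λ ()) , subst (_< n) (sym (swapOdd-odd k)) (≤-<-trans QA' A<n) ,
                     λ x → ne2 (trans (sym gQ) (trans x (swapOdd-odd k))))
      ... | yes eq2 = A , A<n , inj₂ ((λ x → <-irrefl (sym x) (≤-<-trans z≤n QA')) ,
                     subst (_< n) (sym sw2A) Q<n , λ x → CQ (trans (sym gA) (trans x sw2A)))
        where
        sw2A : swapOdd A ≡ Q
        sw2A = trans (cong swapOdd eq2) (swapOdd-even k)

      recovered : RecoveredFrom n f g
      recovered = caseII k , (g0 , (ms1 , ms2) , λ x → CQ (trans (sym gA) (trans (sym (cong g gQ)) x))) , r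
        where
        ms1 : ∀ j → j < k → g (suc (2 * j)) ≡ suc (suc (2 * j)) × g (suc (suc (2 * j))) ≡ suc (2 * j)
        ms1 j j< = trans (glow _ (s≤s z≤n) l1) (swapOdd-odd j) , trans (glow _ (s≤s z≤n) l2) (swapOdd-even j)
          where
          l2' : suc (suc (2 * j)) ≤ 2 * k
          l2' = subst (_≤ 2 * k) (2*suc j) (*-monoʳ-≤ 2 j<)
          l2 : suc (suc (2 * j)) < Q
          l2 = s≤s l2'
          l1 : suc (2 * j) < Q
          l1 = <-trans (n<1+n _) l2
        ms2 : ¬ (g Q ≡ suc Q × g (suc Q) ≡ Q)
        ms2 (x , y) = CQ (trans (sym gA) (trans (cong g (trans (sym gQ) x)) y))
        r : ∀ t → t < n → f t ≡ unψ (caseII k) g t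
        r t p with t <? 2 * k
        ... | yes tl = trans (H1 t tl) (sym (unψ-II.below k g t tl))
        ... | no tl with t ≟ 2 * k
        ...   | yes refl = trans (sym gQ) (sym (unψ-II.at-2k k g))
        ...   | no t2 with t ≟ Q
        ...     | yes refl = trans (sym gA) (trans (cong g (sym gQ)) (sym (unψ-II.at-Q k g)))
        ...     | no tQ with t ≟ A
        ...       | yes refl = trans e (sym (subst (λ w → unψ (caseII k) g w ≡ 2 * k) gQ (unψ-II.at-A k g (subst (Q <_) (sym gQ) QA'))))
        ...       | no tA = trans (sym (grest t p (≮∧≢⇒> (λ x → tl' x) tQ) tA)) (sym (unψ-II.elsewhere k g t (≮∧≢⇒> tl' tQ) (λ x → tA (trans x gQ))))
          where
          tl' : ¬ t < Q
          tl' x = t2 (≤-antisym (≤-pred x) (≮⇒≥ tl))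

    onto : SurjectiveBelow n g
    onto with f A ≟ 2 * k
    ... | yes e = CaseII.onto e
    ... | no ne = CaseI.onto ne
    uniqueFixed : UniqueFixedPoint n g
    uniqueFixed with f A ≟ 2 * k
    ... | yes e = CaseII.uniqueFixed e
    ... | no ne = CaseI.uniqueFixed ne
    unlike′ : Unlike-pairing′ n g
    unlike′ with f A ≟ 2 * k
    ... | yes e = CaseII.unlike′ e
    ... | no ne = CaseI.unlike′ ne
    recovered : RecoveredFrom n f g
    recovered with f A ≟ 2 * k
    ... | yes e = CaseII.recovered e
    ... | no ne = CaseI.recovered ne

module D*Facts {n : ℕ} (n1 : 1 ≤ n) (π : Fin n → Fin n) (pp : IsPerm π) (ds : DStar n π) where
  open OnIndices π pp
  k : ℕ
  k = kOf π
  2k<n : 2 * k < n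
  2k<n = proj₁ (prefix-of-D* π n1 ds)
  open ImageOfD n f fb fi fs (derangement-on-indices π (proj₁ ds)) k 2k<n
         (proj₁ (proj₂ (prefix-of-D* π n1 ds))) (proj₂ (proj₂ (prefix-of-D* π n1 ds))) public

  bridge : ∀ t → t < n → valℕ (ψ π) t ≡ Ψ f k t
  bridge t p = trans (valℕ-inside (ψ π) t p) (trans (toℕ-ψ π (fromℕ< p) 2k<n Qok) (cong (Ψ f k) (FP.toℕ-fromℕ< p)))

surjective-from-indices : ∀ {n} (σ : Fin n → Fin n) → SurjectiveBelow n (valℕ σ) → ∀ y → Σ (Fin n) λ x → σ x ≡ y
surjective-from-indices σ s y with s (toℕ y) (FP.toℕ<n y)
... | t , p , e = fromℕ< p , FP.toℕ-injective (trans (sym (valℕ-inside σ t p)) e)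

oneFixedPoint-from-indices : ∀ {n} (σ : Fin n → Fin n) → UniqueFixedPoint n (valℕ σ) → HasExactlyOneFixedPoint σ
oneFixedPoint-from-indices σ (c , p , gc , uq) = fromℕ< p , FP.toℕ-injective (trans (sym (valℕ-inside σ c p)) (trans gc (sym (FP.toℕ-fromℕ< p)))) ,
  λ y e → FP.toℕ-injective (trans (uq (toℕ y) (FP.toℕ<n y) (trans (valℕ-toℕ σ y) (cong toℕ e))) (sym (FP.toℕ-fromℕ< p)))

≢pairing′-from-indices : ∀ {n} (σ : Fin n → Fin n) → Unlike-pairing′ n (valℕ σ) → ¬ (σ ≗ pairing′)
≢pairing′-from-indices σ (t , p , inj₁ (t0 , ne)) h =
  ne (trans (valℕ-inside σ t p) (trans (cong toℕ (h (fromℕ< p))) (toℕ-pairing′-zero (fromℕ< p) (trans (FP.toℕ-fromℕ< p) t0))))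
≢pairing′-from-indices σ (t , p , inj₂ (t0 , sl , ne)) h =
  ne (trans (valℕ-inside σ t p) (trans (cong toℕ (h (fromℕ< p)))
     (trans (toℕ-pairing′ (fromℕ< p) (λ x → t0 (trans (sym (FP.toℕ-fromℕ< p)) x)) (subst (λ w → swapOdd w < _) (sym (FP.toℕ-fromℕ< p)) sl))
            (cong swapOdd (FP.toℕ-fromℕ< p)))))

ψ-maps-D*-to-F* : ∀ {n} → 1 ≤ n → (π : Fin n → Fin n) → IsPerm π → DStar n π → IsPerm (ψ π) × FStar n (ψ π)
ψ-maps-D*-to-F* n1 π pp ds =
  surjective⇒isPerm (ψ π) (surjective-from-indices (ψ π) G.onto) ,
  oneFixedPoint-from-indices (ψ π) G.uniqueFixed ,
  λ _ → ≢pairing′-from-indices (ψ π) G.unlike′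
  where
  open D*Facts n1 π pp ds
  module G = Image (valℕ (ψ π)) bridge

recovery-unique : ∀ n (f f′ g : ℕ → ℕ) → UniqueFixedPoint n g →
  RecoveredFrom n f g → RecoveredFrom n f′ g → ∀ t → t < n → f t ≡ f′ t
recovery-unique n f f′ g (c , _ , _ , onlyC) (s , hs , f≡) (s′ , hs′ , f′≡) t p
  with HasShape-unique n g (λ a b p q ea eb → trans (onlyC a p ea) (sym (onlyC b q eb))) s s′ hs hs′
... | refl = trans (f≡ t p) (sym (f′≡ t p))

-- ψ π = ψ π′ = g; both π and π′ are recovered from g.
ψ-injective : ∀ {n} → 1 ≤ n → (π π′ : Fin n → Fin n) → IsPerm π → DStar n π → IsPerm π′ → DStar n π′ →
         ψ π ≗ ψ π′ → π ≗ π′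
ψ-injective {n} n1 π π′ pp ds pp′ ds′ ψπ≗ψπ′ x = FP.toℕ-injective (begin
  toℕ (π x)          ≡⟨ valℕ-toℕ π x ⟨
  valℕ π (toℕ x)     ≡⟨ recovery-unique n _ _ g G.uniqueFixed G.recovered G′.recovered (toℕ x) (FP.toℕ<n x) ⟩
  valℕ π′ (toℕ x)    ≡⟨ valℕ-toℕ π′ x ⟩
  toℕ (π′ x)         ∎)
  where
  open ≡-Reasoning
  g : ℕ → ℕ
  g = valℕ (ψ π)
  module D = D*Facts n1 π pp ds
  module D′ = D*Facts n1 π′ pp′ ds′
  module G = D.Image g D.bridge
  module G′ = D′.Image g (λ t p → trans (valℕ-cong (ψ π) (ψ π′) ψπ≗ψπ′ t) (D′.bridge t p))

PairPrefix : (ℕ → ℕ) → ℕ → ℕ → Set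
PairPrefix F n k = (∀ i → i < k → F (2 * i) ≡ suc (2 * i) × F (suc (2 * i)) ≡ 2 * i)
             × (F (2 * k) ≢ suc (2 * k) ⊎ (suc (2 * k) < n × F (suc (2 * k)) ≢ 2 * k))

-- Every F agreeing with r on [0, n) has prefix length k and Ψ F k = g.
-- (Quantifying over F lets r be replaced by valℕ of a map on Fin n.)
Realises : ℕ → (ℕ → ℕ) → ℕ → (ℕ → ℕ) → Set
Realises n r k g = ∀ F → (∀ t → t < n → F t ≡ r t) → PairPrefix F n k × (∀ t → t < n → Ψ F k t ≡ g t)

record Candidate (n : ℕ) (g : ℕ → ℕ) : Set where
  field
    r : ℕ → ℕ
    k : ℕ
    2k<n : 2 * k < n
    bounded : ∀ t → t < n → r t < n
    onto : SurjectiveBelow n r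
    noFixed : ∀ t → t < n → r t ≢ t
    realises : Realises n r k g

swapEven⇒PairPrefix : ∀ (F : ℕ → ℕ) k → (∀ t → t < 2 * k → F t ≡ swapEven t) →
  ∀ i → i < k → F (2 * i) ≡ suc (2 * i) × F (suc (2 * i)) ≡ 2 * i
swapEven⇒PairPrefix F k h i i< = trans (h _ l1) (swapEven-even i) , trans (h _ l2) (swapEven-odd i)
  where
  l2 : suc (2 * i) < 2 * k
  l2 = subst (_≤ 2 * k) (2*suc i) (*-monoʳ-≤ 2 i<)
  l1 : 2 * i < 2 * k
  l1 = <-trans (n<1+n _) l2

-- Shape caseI₀ c: g permutes [0, n) with unique fixed point c ≠ 0.
-- r = unψ (caseI₀ c) g puts c back into the cycle of 0: r 0 = c, r c = g 0.
module PreimageI₀ (n : ℕ) (g : ℕ → ℕ)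
  (gb : ∀ t → t < n → g t < n)
  (gi : ∀ s t → s < n → t < n → g s ≡ g t → s ≡ t)
  (gs : ∀ y → y < n → Σ ℕ λ u → u < n × g u ≡ y)
  (c : ℕ) (c<n : c < n) (c0 : c ≢ 0) (gc : g c ≡ c) (uq : ∀ t → t < n → g t ≡ t → t ≡ c) where

  0<n : 0 < n
  0<n = ≤-<-trans z≤n c<n
  B : ℕ
  B = g 0
  B<n : B < n
  B<n = gb 0 0<n
  B0 : B ≢ 0
  B0 x = c0 (sym (uq 0 0<n x))
  Bc : B ≢ c
  Bc x = c0 (sym (gi 0 c 0<n c<n (trans x (sym gc))))

  r : ℕ → ℕ
  r = unψ (caseI₀ c) g

  bounded : ∀ t → t < n → r t < n
  bounded t p with t ≟ 0
  ... | yes refl = c<n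
  ... | no t0 with t ≟ c
  ...   | yes refl = subst (_< n) (sym (unψ-I₀.at-c c g c0)) B<n
  ...   | no tc = subst (_< n) (sym (unψ-I₀.elsewhere c g t t0 tc)) (gb t p)

  onto : SurjectiveBelow n r
  onto y y<n with y ≟ c
  ... | yes refl = 0 , 0<n , refl
  ... | no yc with y ≟ B
  ...   | yes refl = c , c<n , unψ-I₀.at-c c g c0
  ...   | no yB = u , u<n , trans (unψ-I₀.elsewhere c g u u0 uc) fu
    where
    u : ℕ
    u = proj₁ (gs y y<n)
    u<n : u < n
    u<n = proj₁ (proj₂ (gs y y<n))
    fu : g u ≡ y
    fu = proj₂ (proj₂ (gs y y<n))
    u0 : u ≢ 0
    u0 x = yB (trans (sym fu) (cong g x))
    uc : u ≢ c
    uc x = yc (trans (sym fu) (trans (cong g x) gc))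

  noFixed : ∀ t → t < n → r t ≢ t
  noFixed t p with t ≟ 0
  ... | yes refl = c0
  ... | no t0 with t ≟ c
  ...   | yes refl = λ x → Bc (trans (sym (unψ-I₀.at-c c g c0)) x)
  ...   | no tc = λ x → tc (uq t p (trans (sym (unψ-I₀.elsewhere c g t t0 tc)) x))

  module Realised (F : ℕ → ℕ) (FR : ∀ t → t < n → F t ≡ r t) where
    F0 : F 0 ≡ c
    F0 = FR 0 0<n
    FcB : F c ≡ B
    FcB = trans (FR c c<n) (unψ-I₀.at-c c g c0)

    prefixPairs : PairPrefix F n 0
    prefixPairs = (λ i ()) , h
      where
      h : F 0 ≢ 1 ⊎ (1 < n × F 1 ≢ 0)
      h with c ≟ 1
      ... | no c1 = inj₁ (λ x → c1 (trans (sym F0) x))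
      ... | yes refl = inj₂ (c<n , λ x → B0 (trans (sym FcB) x))

    ne : F (F (2 * 0)) ≢ 2 * 0
    ne x = B0 (trans (sym FcB) (trans (cong F (sym F0)) x))

    open Ψ-CaseI F 0 ne using (I-A; I-0; I-rest)

    Ψ≡ : ∀ t → t < n → Ψ F 0 t ≡ g t
    Ψ≡ t p with t ≟ c
    ... | yes refl = trans (subst (λ w → Ψ F 0 w ≡ w) F0 I-A) (sym gc)
    ... | no tc with t ≟ 0
    ...   | yes refl = trans (I-0 (λ x → c0 (sym (trans x F0)))) (trans (cong F F0) FcB)
    ...   | no t0 = trans (I-rest t (≤∧≢⇒< z≤n (λ x → t0 (sym x))) (λ x → tc (trans x F0)))
                     (trans (FR t p) (unψ-I₀.elsewhere c g t t0 tc))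

  candidate : Candidate n g
  candidate = record { r = r ; k = 0 ; 2k<n = 0<n ; bounded = bounded ; onto = onto ; noFixed = noFixed
                     ; realises = λ F FR → Realised.prefixPairs F FR , Realised.Ψ≡ F FR }

module OddPairingBelow (n : ℕ) (g : ℕ → ℕ)
  (gi : ∀ s t → s < n → t < n → g s ≡ g t → s ≡ t)
  (j : ℕ) (j<n : suc (2 * j) < n)
  (g0 : g 0 ≡ 0) (gsw : ∀ t → 1 ≤ t → t < suc (2 * j) → g t ≡ swapOdd t) where

  fwd : ∀ u → u < suc (2 * j) → g u < suc (2 * j)
  fwd u p with u ≟ 0
  ... | yes refl = subst (_< suc (2 * j)) (sym g0) (s≤s z≤n)
  ... | no u0 = subst (_< suc (2 * j)) (sym (gsw u u1 p)) (proj₂ (swapOdd-range u j u1 p))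
    where
    u1 : 1 ≤ u
    u1 = ≤∧≢⇒< z≤n (λ x → u0 (sym x))

  bwd : ∀ u → u < n → g u < suc (2 * j) → u < suc (2 * j)
  bwd u p q with g u ≟ 0
  ... | yes e = subst (_< suc (2 * j)) (gi 0 u (≤-<-trans z≤n j<n) p (trans g0 (sym e))) (s≤s z≤n)
  ... | no y0 = subst (_< suc (2 * j)) (gi _ u (<-trans (proj₂ rg) j<n) p (trans (gsw _ (proj₁ rg) (proj₂ rg)) (swapOdd-involutive _ y1))) (proj₂ rg)
    where
    y1 : 1 ≤ g u
    y1 = ≤∧≢⇒< z≤n (λ x → y0 (sym x))
    rg : 1 ≤ swapOdd (g u) × swapOdd (g u) < suc (2 * j)
    rg = swapOdd-range (g u) j y1 q

-- Shape caseI₊ k: g fixes only 0, is swapOdd on [1, 2k−1), and (2k−1, a₁) is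
-- a 2-cycle of g with a₁ > 2k.  r = unψ (caseI₊ k) g is swapEven below 2k and
-- reinserts a₁ after 2k: r (2k) = a₁, r a₁ = g (2k).
module PreimageI₊ (n : ℕ) (g : ℕ → ℕ)
  (gb : ∀ t → t < n → g t < n)
  (gi : ∀ s t → s < n → t < n → g s ≡ g t → s ≡ t)
  (gs : ∀ y → y < n → Σ ℕ λ u → u < n × g u ≡ y)
  (nofix : ∀ t → t < n → t ≢ 0 → g t ≢ t)
  (k : ℕ) (k0 : k ≢ 0) (m1<n : 2 * k ∸ 1 < n)
  (g0 : g 0 ≡ 0) (gsw : ∀ t → 1 ≤ t → t < 2 * k ∸ 1 → g t ≡ swapOdd t)
  (kA : 2 * k < g (2 * k ∸ 1)) (gA : g (g (2 * k ∸ 1)) ≡ 2 * k ∸ 1) where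

  m1 : ℕ
  m1 = 2 * k ∸ 1
  A : ℕ
  A = g m1
  A<n : A < n
  A<n = gb m1 m1<n
  k<n : 2 * k < n
  k<n = <-trans kA A<n
  m1<k : m1 < 2 * k
  m1<k = 2*k∸1<2*k k k0
  sm1 : suc m1 ≡ 2 * k
  sm1 = 1+[2*k∸1] k k0

  open OddPairingBelow n g gi (k ∸ 1) (subst (_< n) (sym (1+2*pred k k0)) m1<n) g0
             (λ t p q → gsw t p (subst (t <_) (1+2*pred k k0) q))
  fwd' : ∀ u → u < m1 → g u < m1
  fwd' u p = subst (g u <_) (1+2*pred k k0) (fwd u (subst (u <_) (sym (1+2*pred k k0)) p))
  bwd' : ∀ u → u < n → g u < m1 → u < m1
  bwd' u p q = subst (u <_) (1+2*pred k k0) (bwd u p (subst (g u <_) (sym (1+2*pred k k0)) q))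

  B : ℕ
  B = g (2 * k)
  B<n : B < n
  B<n = gb _ k<n
  BA : B ≢ A
  BA x = <-irrefl (gi m1 (2 * k) m1<n k<n (sym x)) m1<k
  kB : 2 * k < B
  kB = ≤∧≢⇒< (subst (_≤ B) sm1 (≤∧≢⇒< (≮⇒≥ b1) b2)) (λ x → nofix (2 * k) k<n (λ y → <-irrefl (sym y) (≤-<-trans z≤n m1<k)) (sym x))
    where
    b1 : ¬ B < m1
    b1 q = <-asym m1<k (bwd' (2 * k) k<n q)
    b2 : m1 ≢ B
    b2 x = <-irrefl (sym (gi A (2 * k) A<n k<n (trans gA x))) kA

  r : ℕ → ℕ
  r = unψ (caseI₊ k) g

  bounded : ∀ t → t < n → r t < n
  bounded t p with t <? 2 * k
  ... | yes tl = subst (_< n) (sym (unψ-I₊.below k g t tl)) (<-trans (swapEven-< t k tl) k<n)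
  ... | no tl with t ≟ 2 * k
  ...   | yes refl = subst (_< n) (sym (unψ-I₊.at-2k k g)) A<n
  ...   | no t2 with t ≟ A
  ...     | yes refl = subst (_< n) (sym (unψ-I₊.at-A k g kA)) B<n
  ...     | no tA = subst (_< n) (sym (unψ-I₊.elsewhere k g t (≮∧≢⇒> tl t2) tA)) (gb t p)

  onto : SurjectiveBelow n r
  onto y y<n with y <? 2 * k
  ... | yes yl = swapEven y , <-trans (swapEven-< y k yl) k<n , trans (unψ-I₊.below k g (swapEven y) (swapEven-< y k yl)) (swapEven-involutive y)
  ... | no yl with y ≟ A
  ...   | yes refl = 2 * k , k<n , unψ-I₊.at-2k k g
  ...   | no yA with y ≟ B
  ...     | yes refl = A , A<n , unψ-I₊.at-A k g kA
  ...     | no yB = u , u<n , trans (unψ-I₊.elsewhere k g u ku uA) fu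
    where
    u : ℕ
    u = proj₁ (gs y y<n)
    u<n : u < n
    u<n = proj₁ (proj₂ (gs y y<n))
    fu : g u ≡ y
    fu = proj₂ (proj₂ (gs y y<n))
    u1 : ¬ u < m1
    u1 q = yl (<-trans (subst (_< m1) fu (fwd' u q)) m1<k)
    u2 : u ≢ m1
    u2 x = yA (trans (sym fu) (cong g x))
    u3 : u ≢ 2 * k
    u3 x = yB (trans (sym fu) (cong g x))
    ku : 2 * k < u
    ku = ≤∧≢⇒< (subst (_≤ u) sm1 (≮∧≢⇒> u1 u2)) (λ x → u3 (sym x))
    uA : u ≢ A
    uA x = yl (subst (_< 2 * k) (trans (sym gA) (trans (cong g (sym x)) fu)) m1<k)

  noFixed : ∀ t → t < n → r t ≢ t
  noFixed t p with t <? 2 * k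
  ... | yes tl = λ x → swapEven-no-fixed t (trans (sym (unψ-I₊.below k g t tl)) x)
  ... | no tl with t ≟ 2 * k
  ...   | yes refl = λ x → <-irrefl (sym (trans (sym (unψ-I₊.at-2k k g)) x)) kA
  ...   | no t2 with t ≟ A
  ...     | yes refl = λ x → BA (trans (sym (unψ-I₊.at-A k g kA)) x)
  ...     | no tA = λ x → nofix t p (λ y → tl (subst (_< 2 * k) (sym y) (≤-<-trans z≤n m1<k)))
                          (trans (sym (unψ-I₊.elsewhere k g t (≮∧≢⇒> tl t2) tA)) x)

  module Realised (F : ℕ → ℕ) (FR : ∀ t → t < n → F t ≡ r t) where
    eA : F (2 * k) ≡ A
    eA = trans (FR _ k<n) (unψ-I₊.at-2k k g)
    eB : F A ≡ B
    eB = trans (FR _ A<n) (unψ-I₊.at-A k g kA)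
    FB : F (F (2 * k)) ≡ B
    FB = trans (cong F eA) eB

    prefixPairs : PairPrefix F n k
    prefixPairs = swapEven⇒PairPrefix F k (λ t p → trans (FR t (<-trans p k<n)) (unψ-I₊.below k g t p)) , h
      where
      h : F (2 * k) ≢ suc (2 * k) ⊎ (suc (2 * k) < n × F (suc (2 * k)) ≢ 2 * k)
      h with A ≟ suc (2 * k)
      ... | no ne = inj₁ (λ x → ne (trans (sym eA) x))
      ... | yes e = inj₂ (subst (_< n) e A<n , λ x → <-irrefl (sym (trans (sym (trans (cong F (sym e)) eB)) x)) kB)

    ne : F (F (2 * k)) ≢ 2 * k
    ne x = <-irrefl (sym (trans (sym FB) x)) kB

    open Ψ-CaseI F k ne using (I-A; I-0; I-low; I-m1; I-2k; I-rest)

    Ψ≡ : ∀ t → t < n → Ψ F k t ≡ g t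
    Ψ≡ t p with t ≟ A
    ... | yes refl = trans (subst (λ w → Ψ F k w ≡ m1) eA (trans I-A (cong (λ b → if b then F (2 * k) else m1) (≢⇒≡ᵇfalse k0)))) (sym gA)
    ... | no tA with t ≟ 0
    ...   | yes refl = trans (trans (I-0 (λ x → tA (trans x eA))) (cong (λ b → if b then F (F (2 * k)) else 0) (≢⇒≡ᵇfalse k0))) (sym g0)
    ...   | no t0 with t <? m1
    ...     | yes tl = trans (I-low t (λ x → tA (trans x eA)) t0 tl) (sym (gsw t (≤∧≢⇒< z≤n (λ x → t0 (sym x))) tl))
    ...     | no tl with t ≟ m1
    ...       | yes refl = trans (I-m1 k0 (λ x → <-irrefl (trans x eA) (<-trans m1<k kA))) eA
    ...       | no tm with t ≟ 2 * k
    ...         | yes refl = trans (I-2k (λ x → <-irrefl (trans x eA) kA)) FB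
    ...         | no t2 = trans (I-rest t kt (λ x → tA (trans x eA))) (trans (FR t p) (unψ-I₊.elsewhere k g t kt tA))
      where
      kt : 2 * k < t
      kt = ≤∧≢⇒< (subst (_≤ t) sm1 (≮∧≢⇒> tl tm)) (λ x → t2 (sym x))

  candidate : Candidate n g
  candidate = record { r = r ; k = k ; 2k<n = k<n ; bounded = bounded ; onto = onto ; noFixed = noFixed
                     ; realises = λ F FR → Realised.prefixPairs F FR , Realised.Ψ≡ F FR }

-- Shape caseII k: g fixes only 0, is swapOdd on [1, 2k+1), and Q = 2k+1 lies
-- in a longer cycle with a₁ = g Q > Q.  r = unψ (caseII k) g is swapEven
-- below 2k and splits off the 2-cycle (2k, a₁): r (2k) = a₁, r a₁ = 2k, r Q = g a₁.
module PreimageII (n : ℕ) (g : ℕ → ℕ)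
  (gb : ∀ t → t < n → g t < n)
  (gi : ∀ s t → s < n → t < n → g s ≡ g t → s ≡ t)
  (gs : ∀ y → y < n → Σ ℕ λ u → u < n × g u ≡ y)
  (nofix : ∀ t → t < n → t ≢ 0 → g t ≢ t)
  (k : ℕ) (Q<n : suc (2 * k) < n)
  (g0 : g 0 ≡ 0) (gsw : ∀ t → 1 ≤ t → t < suc (2 * k) → g t ≡ swapOdd t)
  (QA : suc (2 * k) < g (suc (2 * k))) (QC0 : g (g (suc (2 * k))) ≢ suc (2 * k)) where

  Q : ℕ
  Q = suc (2 * k)
  A : ℕ
  A = g Q
  A<n : A < n
  A<n = gb Q Q<n
  k<n : 2 * k < n
  k<n = <-trans (n<1+n _) Q<n
  C : ℕ
  C = g A
  C<n : C < n
  C<n = gb A A<n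

  open OddPairingBelow n g gi k Q<n g0 gsw

  r : ℕ → ℕ
  r = unψ (caseII k) g

  bounded : ∀ t → t < n → r t < n
  bounded t p with t <? 2 * k
  ... | yes tl = subst (_< n) (sym (unψ-II.below k g t tl)) (<-trans (swapEven-< t k tl) k<n)
  ... | no tl with t ≟ 2 * k
  ...   | yes refl = subst (_< n) (sym (unψ-II.at-2k k g)) A<n
  ...   | no t2 with t ≟ Q
  ...     | yes refl = subst (_< n) (sym (unψ-II.at-Q k g)) C<n
  ...     | no tQ with t ≟ A
  ...       | yes refl = subst (_< n) (sym (unψ-II.at-A k g QA)) k<n
  ...       | no tA = subst (_< n) (sym (unψ-II.elsewhere k g t (≮∧≢⇒> tQ' tQ) tA)) (gb t p)
    where
    tQ' : ¬ t < Q
    tQ' x = t2 (≤-antisym (≤-pred x) (≮⇒≥ tl))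

  onto : SurjectiveBelow n r
  onto y y<n with y <? 2 * k
  ... | yes yl = swapEven y , <-trans (swapEven-< y k yl) k<n , trans (unψ-II.below k g (swapEven y) (swapEven-< y k yl)) (swapEven-involutive y)
  ... | no yl with y ≟ 2 * k
  ...   | yes refl = A , A<n , unψ-II.at-A k g QA
  ...   | no y2 with y ≟ A
  ...     | yes refl = 2 * k , k<n , unψ-II.at-2k k g
  ...     | no yA with y ≟ C
  ...       | yes refl = Q , Q<n , unψ-II.at-Q k g
  ...       | no yC = u , u<n , trans (unψ-II.elsewhere k g u Qu uA) fu
    where
    u : ℕ
    u = proj₁ (gs y y<n)
    u<n : u < n
    u<n = proj₁ (proj₂ (gs y y<n))
    fu : g u ≡ y
    fu = proj₂ (proj₂ (gs y y<n))
    u1 : ¬ u < Q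
    u1 q = y2 (≤-antisym (≤-pred (subst (_< Q) fu (fwd u q))) (≮⇒≥ yl))
    u2 : u ≢ Q
    u2 x = yA (trans (sym fu) (cong g x))
    Qu : Q < u
    Qu = ≮∧≢⇒> u1 u2
    uA : u ≢ A
    uA x = yC (trans (sym fu) (cong g x))

  noFixed : ∀ t → t < n → r t ≢ t
  noFixed t p with t <? 2 * k
  ... | yes tl = λ x → swapEven-no-fixed t (trans (sym (unψ-II.below k g t tl)) x)
  ... | no tl with t ≟ 2 * k
  ...   | yes refl = λ x → <-irrefl (sym (trans (sym (unψ-II.at-2k k g)) x)) (<-trans (n<1+n _) QA)
  ...   | no t2 with t ≟ Q
  ...     | yes refl = λ x → QC0 (trans (sym (unψ-II.at-Q k g)) x)
  ...     | no tQ with t ≟ A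
  ...       | yes refl = λ x → <-irrefl (trans (sym (unψ-II.at-A k g QA)) x) (<-trans (n<1+n _) QA)
  ...       | no tA = λ x → nofix t p (λ y → <-irrefl (sym y) (≤-<-trans z≤n (≮∧≢⇒> tQ' tQ)))
                          (trans (sym (unψ-II.elsewhere k g t (≮∧≢⇒> tQ' tQ) tA)) x)
    where
    tQ' : ¬ t < Q
    tQ' x = t2 (≤-antisym (≤-pred x) (≮⇒≥ tl))

  module Realised (F : ℕ → ℕ) (FR : ∀ t → t < n → F t ≡ r t) where
    eA : F (2 * k) ≡ A
    eA = trans (FR _ k<n) (unψ-II.at-2k k g)
    e2 : F A ≡ 2 * k
    e2 = trans (FR _ A<n) (unψ-II.at-A k g QA)
    eC : F Q ≡ C
    eC = trans (FR _ Q<n) (unψ-II.at-Q k g)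
    e : F (F (2 * k)) ≡ 2 * k
    e = trans (cong F eA) e2

    prefixPairs : PairPrefix F n k
    prefixPairs = swapEven⇒PairPrefix F k (λ t p → trans (FR t (<-trans p k<n)) (unψ-II.below k g t p)) ,
         inj₁ (λ x → <-irrefl (sym (trans (sym eA) x)) QA)

    open Ψ-CaseII F k e using (II-0; II-low; II-Q; II-A; II-rest)

    Ψ≡ : ∀ t → t < n → Ψ F k t ≡ g t
    Ψ≡ t p with t ≟ 0
    ... | yes refl = trans II-0 (sym g0)
    ... | no t0 with t <? Q
    ...   | yes tl = trans (II-low t (≤∧≢⇒< z≤n (λ x → t0 (sym x))) tl) (sym (gsw t (≤∧≢⇒< z≤n (λ x → t0 (sym x))) tl))
    ...   | no tl with t ≟ Q
    ...     | yes refl = trans II-Q eA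
    ...     | no tQ with t ≟ A
    ...       | yes refl = trans (subst (λ w → Ψ F k w ≡ F Q) eA (II-A (subst (Q <_) (sym eA) QA))) eC
    ...       | no tA = trans (II-rest t (≮∧≢⇒> tl tQ) (λ x → tA (trans x eA))) (trans (FR t p) (unψ-II.elsewhere k g t (≮∧≢⇒> tl tQ) tA))

  candidate : Candidate n g
  candidate = record { r = r ; k = k ; 2k<n = k<n ; bounded = bounded ; onto = onto ; noFixed = noFixed
                     ; realises = λ F FR → Realised.prefixPairs F FR , Realised.Ψ≡ F FR }

≗pairing⇒swapEven : ∀ {n} (π : Fin n → Fin n) → π ≗ pairing → ∀ t → t < n → swapEven t < n → valℕ π t ≡ swapEven t
≗pairing⇒swapEven π π≗pairing t p q = begin
  valℕ π t                   ≡⟨ valℕ-inside π t p ⟩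
  toℕ (π (fromℕ< p))         ≡⟨ cong toℕ (π≗pairing (fromℕ< p)) ⟩
  toℕ (pairing (fromℕ< p))   ≡⟨ toℕ-pairing (fromℕ< p) (subst (λ w → swapEven w < _) (sym (FP.toℕ-fromℕ< p)) q) ⟩
  swapEven (toℕ (fromℕ< p))  ≡⟨ cong swapEven (FP.toℕ-fromℕ< p) ⟩
  swapEven t                 ∎
  where open ≡-Reasoning

-- Prefix length k with 2k < n rules out (1,2)(3,4)⋯ when n is even: either
-- the pattern visibly breaks at (2k, 2k+1), or 2k+1 = n is odd.
PairPrefix⇒≢pairing : ∀ {n} (π : Fin n → Fin n) k → 2 * k < n → PairPrefix (valℕ π) n k → 2 ∣ n → ¬ (π ≗ pairing)
PairPrefix⇒≢pairing {n} π k 2k<n (_ , breaks) 2∣n π≗pairing = refute (suc (2 * k) <? n) breaks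
  where
  refute : Dec (suc (2 * k) < n) →
           valℕ π (2 * k) ≢ suc (2 * k) ⊎ (suc (2 * k) < n × valℕ π (suc (2 * k)) ≢ 2 * k) → ⊥
  refute (no q) _ = 2∤1+2*k k (subst (2 ∣_) (≤-antisym (≮⇒≥ q) 2k<n) 2∣n)
  refute (yes q) (inj₁ a) =
    a (trans (≗pairing⇒swapEven π π≗pairing (2 * k) 2k<n (subst (_< n) (sym (swapEven-even k)) q)) (swapEven-even k))
  refute (yes q) (inj₂ (_ , b)) =
    b (trans (≗pairing⇒swapEven π π≗pairing (suc (2 * k)) q (subst (_< n) (sym (swapEven-odd k)) 2k<n)) (swapEven-odd k))

kOf-from-PairPrefix : ∀ {n} (π : Fin n → Fin n) k → 2 * k < n → PairPrefix (valℕ π) n k → kOf π ≡ k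
kOf-from-PairPrefix {n} π k 2k<n (pairs , breaks) =
  trans (countPairs≡countWhile π n 0)
        (countWhile-unique (pairAt π) n k (λ i p → ⇒pairAt-true π i (proj₁ (pairs i p)) (proj₂ (pairs i p)))
                           (breaksAt breaks) (≤-trans (m≤n*m k 2) (<⇒≤ 2k<n)))
  where
  breaksAt : valℕ π (2 * k) ≢ suc (2 * k) ⊎ (suc (2 * k) < n × valℕ π (suc (2 * k)) ≢ 2 * k) → pairAt π k ≡ false
  breaksAt (inj₁ a) = ⇒pairAt-false₁ π k a
  breaksAt (inj₂ (_ , b)) = ⇒pairAt-false₂ π k b

fromIndices : ∀ {n} (r : ℕ → ℕ) → (∀ t → t < n → r t < n) → Fin n → Fin n
fromIndices r bounded x = fromℕ< (bounded (toℕ x) (FP.toℕ<n x))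

valℕ-fromIndices : ∀ {n} (r : ℕ → ℕ) (bounded : ∀ t → t < n → r t < n) →
  ∀ t → t < n → valℕ (fromIndices r bounded) t ≡ r t
valℕ-fromIndices r bounded t p =
  trans (valℕ-inside (fromIndices r bounded) t p) (trans (FP.toℕ-fromℕ< _) (cong r (FP.toℕ-fromℕ< p)))

preimage-from-indices : ∀ {n} → 1 ≤ n → (σ : Fin n → Fin n) → Candidate n (valℕ σ) →
  Σ (Fin n → Fin n) λ π → IsPerm π × DStar n π × ψ π ≗ σ
preimage-from-indices {n} n1 σ C = π , πPerm , πD* , ψπ≗σ
  where
  open Candidate C
  open ≡-Reasoning
  π : Fin n → Fin n
  π = fromIndices r bounded
  π≡r : ∀ t → t < n → valℕ π t ≡ r t
  π≡r = valℕ-fromIndices r bounded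
  πPerm : IsPerm π
  πPerm = surjective⇒isPerm π (surjective-from-indices π λ y p →
    let (t , q , e) = onto y p in t , q , trans (π≡r t q) e)
  prefix : PairPrefix (valℕ π) n k
  prefix = proj₁ (realises (valℕ π) π≡r)
  πD* : DStar n π
  πD* = (λ x e → noFixed (toℕ x) (FP.toℕ<n x) (trans (sym (π≡r _ (FP.toℕ<n x))) (trans (valℕ-toℕ π x) (cong toℕ e))))
      , PairPrefix⇒≢pairing π k 2k<n prefix
  ψπ≗σ : ψ π ≗ σ
  ψπ≗σ x = FP.toℕ-injective (begin
    toℕ (ψ π x)                 ≡⟨ valℕ-toℕ (ψ π) x ⟨
    valℕ (ψ π) (toℕ x)          ≡⟨ D*Facts.bridge n1 π πPerm πD* (toℕ x) (FP.toℕ<n x) ⟩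
    Ψ (valℕ π) (kOf π) (toℕ x)  ≡⟨ cong (λ w → Ψ (valℕ π) w (toℕ x)) (kOf-from-PairPrefix π k 2k<n prefix) ⟩
    Ψ (valℕ π) k (toℕ x)        ≡⟨ proj₂ (realises (valℕ π) π≡r) (toℕ x) (FP.toℕ<n x) ⟩
    valℕ σ (toℕ x)              ≡⟨ valℕ-toℕ σ x ⟩
    toℕ (σ x)                   ∎)

oddPairAt : (ℕ → ℕ) → ℕ → Bool
oddPairAt g j = (g (suc (2 * j)) ≡ᵇ suc (suc (2 * j))) ∧ (g (suc (suc (2 * j))) ≡ᵇ suc (2 * j))

oddPairAt-true⇒ : ∀ g j → oddPairAt g j ≡ true → g (suc (2 * j)) ≡ suc (suc (2 * j)) × g (suc (suc (2 * j))) ≡ suc (2 * j)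
oddPairAt-true⇒ g j e with ∧-true e
... | (a , b) = ≡ᵇtrue⇒≡ a , ≡ᵇtrue⇒≡ b

oddPairAt-false⇒ : ∀ g j → oddPairAt g j ≡ false → ¬ (g (suc (2 * j)) ≡ suc (suc (2 * j)) × g (suc (suc (2 * j))) ≡ suc (2 * j))
oddPairAt-false⇒ g j e (a , b) with ∧-false e
... | inj₁ x = true≢false (trans (sym (≡⇒≡ᵇtrue a)) x)
... | inj₂ y = true≢false (trans (sym (≡⇒≡ᵇtrue b)) y)

oddPairs-below-n-impossible : ∀ n → 1 ≤ n → (∀ j → j < n → suc (suc (2 * j)) < n) → ⊥
oddPairs-below-n-impossible (suc n') _ h = ≤⇒≯ (m≤m+n n' (n' + 0)) (<-trans (n<1+n _) (≤-pred (h n' (n<1+n n'))))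

oddPairs⇒2*m<n : ∀ n m → 1 ≤ n → (∀ j → j < m → suc (suc (2 * j)) < n) → 2 * m < n
oddPairs⇒2*m<n n zero n1 h = n1
oddPairs⇒2*m<n n (suc j) n1 h = subst (_< n) (sym (2*suc j)) (h j (n<1+n j))

oneFixedPoint-to-indices : ∀ {n} (σ : Fin n → Fin n) → HasExactlyOneFixedPoint σ → UniqueFixedPoint n (valℕ σ)
oneFixedPoint-to-indices σ (x₀ , σx₀≡x₀ , onlyX₀) =
  toℕ x₀ , FP.toℕ<n x₀ , trans (valℕ-toℕ σ x₀) (cong toℕ σx₀≡x₀) ,
  λ t p e → trans (sym (FP.toℕ-fromℕ< p)) (cong toℕ (onlyX₀ (fromℕ< p)
              (FP.toℕ-injective (trans (sym (valℕ-inside σ t p)) (trans e (sym (FP.toℕ-fromℕ< p)))))))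

-- σ ∈ ℱ*ₙ whose fixed point is 0 has shape caseII m or caseI₊ (m+1), where m
-- is the number of leading odd pairs; the case depends on whether the cycle
-- of 2m+1 is a 2-cycle.
module FixedAtZero {n : ℕ} (n1 : 1 ≤ n) (σ : Fin n → Fin n) (pp : IsPerm σ)
  (≢pairing′ : ¬ (2 ∣ n) → ¬ (σ ≗ pairing′))
  (nofix : ∀ t → t < n → t ≢ 0 → valℕ σ t ≢ t) (g0 : valℕ σ 0 ≡ 0) where
  open OnIndices σ pp renaming (f to g; fb to gb; fi to gi; fs to gs)

  m : ℕ
  m = countWhile (oddPairAt g) n 0

  paired : ∀ j → j < m → g (suc (2 * j)) ≡ suc (suc (2 * j)) × g (suc (suc (2 * j))) ≡ suc (2 * j)
  paired j p = oddPairAt-true⇒ g j (proj₁ (proj₂ (countWhile-spec (oddPairAt g) n 0)) j z≤n p)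

  pairedBelow : ∀ j → j < m → suc (suc (2 * j)) < n
  pairedBelow j p = valℕ≡suc⇒suc< σ (suc (2 * j)) (proj₁ (paired j p))

  2m<n : 2 * m < n
  2m<n = oddPairs⇒2*m<n n m n1 pairedBelow

  notPaired : ¬ (g (suc (2 * m)) ≡ suc (suc (2 * m)) × g (suc (suc (2 * m))) ≡ suc (2 * m))
  notPaired with proj₂ (proj₂ (countWhile-spec (oddPairAt g) n 0))
  ... | inj₁ x = oddPairAt-false⇒ g m x
  ... | inj₂ y = ⊥-elim (oddPairs-below-n-impossible n n1 (λ j p → pairedBelow j (subst (j <_) (sym (trans y (+-identityʳ n))) p)))

  gsw : ∀ t → 1 ≤ t → t < suc (2 * m) → g t ≡ swapOdd t
  gsw (suc u) _ q = pairs⇒below (λ u → g (suc u) ≡ swapOdd (suc u)) m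
    (λ j p → trans (proj₁ (paired j p)) (sym (swapOdd-odd j)) , trans (proj₂ (paired j p)) (sym (swapOdd-even j))) u (≤-pred q)

  σ≗pairing′ : n ≡ suc (2 * m) → σ ≗ pairing′
  σ≗pairing′ n≡ x with toℕ x ≟ 0
  ... | yes t0 = FP.toℕ-injective (trans (sym (valℕ-toℕ σ x)) (trans (cong g t0) (trans g0 (sym (toℕ-pairing′-zero x t0)))))
  ... | no t0 = FP.toℕ-injective (trans (sym (valℕ-toℕ σ x)) (trans (gsw (toℕ x) t1 tl)
                  (sym (toℕ-pairing′ x t0 (subst (swapOdd (toℕ x) <_) (sym n≡) (proj₂ (swapOdd-range (toℕ x) m t1 tl)))))))
    where
    t1 : 1 ≤ toℕ x
    t1 = ≤∧≢⇒< z≤n (λ y → t0 (sym y))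
    tl : toℕ x < suc (2 * m)
    tl = subst (toℕ x <_) n≡ (FP.toℕ<n x)

  -- That involution is excluded from ℱ*ₙ (n is then odd), so 2m+1 < n.
  Q<n : suc (2 * m) < n
  Q<n = decide (suc (2 * m) <? n)
    where
    decide : Dec (suc (2 * m) < n) → suc (2 * m) < n
    decide (yes q) = q
    decide (no q) = ⊥-elim (≢pairing′ (λ 2∣n → 2∤1+2*k m (subst (2 ∣_) n≡ 2∣n)) (σ≗pairing′ n≡))
      where
      n≡ : n ≡ suc (2 * m)
      n≡ = ≤-antisym (≮⇒≥ q) 2m<n

  open OddPairingBelow n g gi m Q<n g0 gsw

  A : ℕ
  A = g (suc (2 * m))
  QA : suc (2 * m) < A
  QA = ≤∧≢⇒< (≮⇒≥ (λ q → <-irrefl refl (bwd (suc (2 * m)) Q<n q))) (λ e → nofix (suc (2 * m)) Q<n (λ ()) (sym e))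

  candidate : Candidate n g
  candidate = split (g A ≟ suc (2 * m))
    where
    split : Dec (g A ≡ suc (2 * m)) → Candidate n g
    split (no ngA) = PreimageII.candidate n g gb gi gs nofix m Q<n g0 gsw QA ngA
    split (yes gA) = PreimageI₊.candidate n g gb gi gs nofix (suc m) (λ ()) (subst (_< n) e1 Q<n) g0
                       (λ t p q → gsw t p (subst (t <_) (sym e1) q)) kA (subst (λ w → g (g w) ≡ w) e1 gA)
      where
      e1 : suc (2 * m) ≡ 2 * suc m ∸ 1
      e1 = 1+2*pred (suc m) (λ ())
      kA : 2 * suc m < g (2 * suc m ∸ 1)
      kA = subst (2 * suc m <_) (cong g e1) (subst (_< A) (sym (2*suc m))
             (≤∧≢⇒< QA (λ x → notPaired (sym x , trans (cong g x) gA))))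

ψ-surjective : ∀ {n} → 1 ≤ n → (σ : Fin n → Fin n) → IsPerm σ → FStar n σ →
         Σ (Fin n → Fin n) λ π → IsPerm π × DStar n π × ψ π ≗ σ
ψ-surjective {n} n1 σ pp (oneFix , ≢pairing′) = preimage-from-indices n1 σ (candidate (oneFixedPoint-to-indices σ oneFix))
  where
  open OnIndices σ pp renaming (f to g; fb to gb; fi to gi; fs to gs)
  candidate : UniqueFixedPoint n g → Candidate n g
  candidate (c , c<n , gc , onlyC) with c ≟ 0
  ... | no c≢0 = PreimageI₀.candidate n g gb gi gs c c<n c≢0 gc onlyC
  ... | yes refl = FixedAtZero.candidate n1 σ pp ≢pairing′ (λ t p t≢0 e → t≢0 (onlyC t p e)) gc

mainTheorem1 : (n : ℕ) → 1 ≤ n →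
    ((π : Fin n → Fin n) → IsPerm π → DStar n π → 2 * kOf π < n)
    × ((π : Fin n → Fin n) → IsPerm π → DStar n π → IsPerm (ψ π) × FStar n (ψ π))
    × ((π π′ : Fin n → Fin n) → IsPerm π → DStar n π → IsPerm π′ → DStar n π′ →
    ψ π ≗ ψ π′ → π ≗ π′)
    × ((σ : Fin n → Fin n) → IsPerm σ → FStar n σ →
    Σ (Fin n → Fin n) λ π → IsPerm π × DStar n π × ψ π ≗ σ)
mainTheorem1 n n1 =
  (λ π _ ds → proj₁ (prefix-of-D* π n1 ds)) ,
  ψ-maps-D*-to-F* n1 ,
  ψ-injective n1 ,
  ψ-surjective n1
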